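{- Let $k,t$ be positive integers and let $(H,w)$ be a $2k$-wide bipartite signed edge-weighted $t$-tree. Add a new vertex $u$ adjacent to all $t$ vertices of a $t$-clique $K_t$ of $H$, and assign to each new edge a nonzero integer weight (of absolute value at most $k$) such that the resulting signed edge-weighted $(t+1)$-clique $(K,w)$ on $V(K_t)\cup\{u\}$ is bipartite and $2k$-wide. Then the resulting bipartite signed edge-weighted $t$-tree is also $2k$-wide.
   Context: A $t$-tree is a graph obtained from $K_{t+1}$ by repeatedly adding a new vertex joined to all vertices of an existing subgraph isomorphic to $K_t$. A signed graph is a graph with a signature $\sigma:E\to\{+,-\}$; the sign of a cycle is the product of its edge signs; the unbalanced girth is the length of a shortest negative cycle. A signed edge-weighted graph $(H,w)$ is a graph with $w:E(H)\to\mathbb{Z}\setminus\{0\}$; it is bipartite if there is a partition $\{X,Y\}$ of $V(H)$ such that edges between $X$ and $Y$ have odd weight and edges inside $X$ or inside $Y$ have even weight. For $(H,w)$ with $1\le|w(e)|\le k$ on all edges, the signed graph $\overline{\overline{(H,w)}}_{ -2k}$ is obtained by replacing each edge $e=xy$ by two internally disjoint $x$–$y$ paths, one of length $|w(e)|$ with the sign of $w(e)$ and one of length $2k-|w(e)|$ with the opposite sign (signs of paths being products of edge signs). $(H,w)$ is $2k$-wide if $\overline{\overline{(H,w)}}_{ -2k}$ has unbalanced girth equal to $2k$ (this notion presupposes $1\le |w(e)|\le k$ for all edges). -}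

module Defs where

open import Data.Nat as ℕ using (ℕ; zero; suc; _≤_; _<_; _<ᵇ_; _∸_; _*_)
open import Data.Nat.Divisibility using (_∣_)
open import Data.Integer as ℤ using (ℤ; ∣_∣)
open import Data.Bool using (Bool; true; false; T; not; _∧_; _xor_; if_then_else_)
open import Data.Bool.Properties using (T?)
open import Data.Fin using (Fin; toℕ; inject₁; fromℕ; lower₁)
open import Data.Fin.Subset using (Subset; _∈_)
open import Data.Fin.Permutation using (Permutation′; _⟨$⟩ʳ_)
import Data.Fin.Subset as Sub
open import Data.Vec using (lookup)
open import Data.Product using (Σ; _×_; _,_; proj₁; proj₂)
open import Data.Sum using (_⊎_; inj₁; inj₂)
open import Data.Empty using (⊥)
open import Relation.Nullary using (¬_; yes; no)
open import Relation.Nullary.Decidable using (⌊_⌋)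
open import Relation.Binary.PropositionalEquality using (_≡_; _≢_)
open import Function.Definitions using (Injective)

record SignedMultigraph : Set₁ where
  field
    V    : Set
    E    : Set
    ends : E → V × V
    neg  : E → Bool

open SignedMultigraph public

next : ∀ {m} → Fin (suc m) → Fin (suc m)
next {m} i with m ℕ.≟ toℕ i
... | yes _ = Fin.zero
... | no ne = Fin.suc (lower₁ i ne)

signProd : (ℓ : ℕ) → (Fin ℓ → Bool) → Bool
signProd zero    f = false
signProd (suc ℓ) f = f Fin.zero xor signProd ℓ (λ i → f (Fin.suc i))

Joins : (G : SignedMultigraph) → E G → V G → V G → Set
Joins G e a b = (ends G e ≡ (a , b)) ⊎ (ends G e ≡ (b , a))

record NegCycle′ (G : SignedMultigraph) (m : ℕ) : Set where
  field
    vs       : Fin (suc m) → V G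
    es       : Fin (suc m) → E G
    vs-inj   : Injective _≡_ _≡_ vs
    es-inj   : Injective _≡_ _≡_ es
    joins    : ∀ i → Joins G (es i) (vs i) (vs (next i))
    negative : signProd (suc m) (λ i → neg G (es i)) ≡ true

NegCycle : SignedMultigraph → ℕ → Set
NegCycle G zero    = ⊥
NegCycle G (suc m) = NegCycle′ G m

UnbalancedGirthIs : SignedMultigraph → ℕ → Set
UnbalancedGirthIs G g = NegCycle G g × (∀ ℓ → ℓ < g → ¬ NegCycle G ℓ)

-- Signed edge-weighted graphs on Fin n: w x y = 0 means "no edge",
-- otherwise w x y is the (nonzero) weight of the edge xy.

WGraph : ℕ → Set
WGraph n = Fin n → Fin n → ℤ

IsWGraph : ∀ {n} → WGraph n → Set
IsWGraph w = (∀ x y → w x y ≡ w y x) × (∀ x → w x x ≡ ℤ.0ℤ)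

adj : ∀ {n} → WGraph n → Fin n → Fin n → Bool
adj w x y = not ⌊ w x y ℤ.≟ ℤ.0ℤ ⌋

Bipartite : ∀ {n} → WGraph n → Set
Bipartite {n} w = Σ (Fin n → Bool) λ side → ∀ x y → adj w x y ≡ true →
  (side x ≡ side y → 2 ∣ ∣ w x y ∣) × (side x ≢ side y → ¬ (2 ∣ ∣ w x y ∣))

module Double (k : ℕ) {n : ℕ} (w : WGraph n) where

  -- each edge counted once, as (x , y) with x < y
  Edge : Set
  Edge = Σ (Fin n × Fin n) λ p → T ((toℕ (proj₁ p) <ᵇ toℕ (proj₂ p)) ∧ adj w (proj₁ p) (proj₂ p))

  src tgt : Edge → Fin n
  src e = proj₁ (proj₁ e)
  tgt e = proj₂ (proj₁ e)

  wt : Edge → ℤ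
  wt e = w (src e) (tgt e)

  -- path true : length |w(e)|, sign of w(e)
  -- path false: length 2k-|w(e)|, opposite sign
  len : Edge → Bool → ℕ
  len e true  = ∣ wt e ∣
  len e false = 2 * k ∸ ∣ wt e ∣

  isNeg : ℤ → Bool
  isNeg z = ⌊ z ℤ.<? ℤ.0ℤ ⌋

  pathNeg : Edge → Bool → Bool
  pathNeg e true  = isNeg (wt e)
  pathNeg e false = not (isNeg (wt e))

  -- vertices: original vertices, plus internal vertices i = 1 .. len-1
  -- (represented by suc i) of each of the two paths of each edge
  Vert : Set
  Vert = Fin n ⊎ Σ Edge λ e → Σ Bool λ p → Σ ℕ λ i → T (suc i <ᵇ len e p)

  -- j-th vertex along path p of e (0 = src e, len = tgt e)
  vertexAt : Edge → Bool → ℕ → Vert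
  vertexAt e p zero = inj₁ (src e)
  vertexAt e p (suc i) with T? (suc i <ᵇ len e p)
  ... | yes t = inj₂ (e , p , i , t)
  ... | no _  = inj₁ (tgt e)

  DEdge : Set
  DEdge = Σ Edge λ e → Σ Bool λ p → Σ ℕ λ j → T (j <ᵇ len e p)

  dends : DEdge → Vert × Vert
  dends (e , p , j , _) = vertexAt e p j , vertexAt e p (suc j)

  dneg : DEdge → Bool
  dneg (e , p , zero  , _) = pathNeg e p
  dneg (e , p , suc j , _) = false

  graph : SignedMultigraph
  graph = record { V = Vert ; E = DEdge ; ends = dends ; neg = dneg }

Wide : ℕ → ∀ {n} → WGraph n → Set
Wide k w = (∀ x y → adj w x y ≡ true → ∣ w x y ∣ ≤ k)
         × UnbalancedGirthIs (Double.graph k w) (2 * k)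

-- t-tree with vertices added in index order: vertex n (= fromℕ n) of the
-- graph on Fin (suc n) is added last.
data OrderedTTree (t : ℕ) : (n : ℕ) → (Fin n → Fin n → Bool) → Set where
  base : (A : Fin (suc t) → Fin (suc t) → Bool) →
         (∀ i j → i ≢ j → A i j ≡ true) →
         (∀ i → A i i ≡ false) →
         OrderedTTree t (suc t) A
  step : ∀ {n} (A : Fin n → Fin n → Bool) (A′ : Fin (suc n) → Fin (suc n) → Bool) →
         OrderedTTree t n A →
         (∀ i j → A′ (inject₁ i) (inject₁ j) ≡ A i j) →
         (S : Subset n) → Sub.∣ S ∣ ≡ t →
         (∀ i j → i ∈ S → j ∈ S → i ≢ j → A i j ≡ true) →
         (∀ i → A′ (fromℕ n) (inject₁ i) ≡ lookup S i) →
         (∀ i → A′ (inject₁ i) (fromℕ n) ≡ lookup S i) →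
         A′ (fromℕ n) (fromℕ n) ≡ false →
         OrderedTTree t (suc n) A′

IsTTree : ℕ → ∀ {n} → WGraph n → Set
IsTTree t {n} w = Σ (Permutation′ n) λ π →
  OrderedTTree t n (λ i j → adj w (π ⟨$⟩ʳ i) (π ⟨$⟩ʳ j))

{-# OPTIONS --safe #-}
module Submission where

-- Write D(G) for the signed graph obtained from (G, w) by replacing every edge by its two
-- paths (Double.graph).  D(H′) is the union of copies of D(H) and D(K) that overlap in the
-- gadgets of the clique S.  The negative 2k-cycle of D(H) survives in D(H′), so it remains to
-- rule out negative closed walks W of D(H′) shorter than 2k.  If W avoids D(H), it lies in D(K).
-- Otherwise start W in D(H): every excursion of W through the gadgets at u is a walk of D(K)
-- between two vertices a, b of S, shorter than 2k.  Since K is 2k-wide, closing the excursion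
-- with the a–b path of opposite sign gives a negative closed walk, so the excursion is at least as
-- long as the a–b path of the same sign, and that path lies in D(H).  Replacing every excursion
-- this way turns W into a negative closed walk of D(H) shorter than 2k, contradicting wideness of H.

open import Defs
open import Data.Nat as ℕ using (ℕ; zero; suc; _≤_; _<_; _+_; _∸_; _*_; z≤n; s≤s; _<ᵇ_)
import Data.Nat.Properties as ℕP
open import Data.Integer as ℤ using (ℤ; ∣_∣; -[1+_])
open import Data.Bool as Bool using (Bool; true; false; not; _xor_; _∧_; T)
open import Data.Bool.Properties
  using (T?; T-irrelevant; T-∧; T-≡; not-¬; not-involutive; xor-assoc; xor-comm; xor-same; xor-identityʳ;
         xor-inverseʳ; ∧-zeroʳ; xor-∧-commutativeRing)
open import Data.Unit using (tt)
open import Data.Fin as Fin using (Fin; toℕ; inject₁; fromℕ)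
import Data.Fin.Properties as FinP
open import Data.Fin.Relation.Unary.Top using (view; ‵fromℕ; ‵inject₁)
open import Data.Fin.Subset using (Subset; _∈_)
import Data.Fin.Subset as Sub
open import Data.Vec using (lookup)
open import Data.Vec.Properties using (lookup⇒[]=)
open import Data.Product using (Σ; ∃; ∃₂; _×_; _,_; proj₁; proj₂)
import Data.Product.Properties as ProductP
open import Data.Sum using (_⊎_; inj₁; inj₂)
import Data.Sum.Properties as SumP
open import Data.Empty using (⊥-elim)
open import Function using (_∘_)
open import Function.Definitions using (Injective)
open import Function.Bundles using (_⇔_; Equivalence)
open import Relation.Nullary using (¬_; yes; no)
open import Relation.Nullary.Decidable using (⌊_⌋; _×-dec_)
open import Relation.Binary.Definitions using (DecidableEquality; tri<; tri≈; tri>)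
open import Relation.Binary.PropositionalEquality
  using (_≡_; _≢_; refl; sym; trans; cong; cong₂; subst; subst₂; module ≡-Reasoning)
open import Algebra.Solver.Ring.AlmostCommutativeRing using (fromCommutativeRing)
import Algebra.Solver.Ring.Simple as RingSolver

xor≡true : ∀ a b → a xor b ≡ true → a ≡ true ⊎ b ≡ true
xor≡true true  _ _  = inj₁ refl
xor≡true false _ eq = inj₂ eq

xor-telescope : ∀ a b c d e → (a xor (b xor c)) xor (d xor (c xor e)) ≡ (a xor d) xor (b xor e)
xor-telescope = solve 5 (λ a b c d e → (a :+ (b :+ c)) :+ (d :+ (c :+ e)) := (a :+ d) :+ (b :+ e)) refl
  where open RingSolver (fromCommutativeRing xor-∧-commutativeRing) Bool._≟_

not-∧ : ∀ c s → not c ∧ s ≡ s xor (c ∧ s)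
not-∧ true  true  = refl
not-∧ true  false = refl
not-∧ false true  = refl
not-∧ false false = refl

isZero : ℕ → Bool
isZero zero    = true
isZero (suc _) = false

isInner : ℕ → ℕ → Bool
isInner j L = (0 <ᵇ j) ∧ (j <ᵇ L)

isZero-∸ : ∀ L j → j < L → isZero (L ∸ suc j) ≡ not (suc j <ᵇ L)
isZero-∸ (suc zero)    zero    _         = refl
isZero-∸ (suc (suc L)) zero    _         = refl
isZero-∸ (suc L)       (suc j) (s≤s j<L) = isZero-∸ L j j<L

<ᵇ-true : ∀ {a b} → a < b → (a <ᵇ b) ≡ true
<ᵇ-true a<b = Equivalence.to T-≡ (ℕP.<⇒<ᵇ a<b)

suc-∸-suc : ∀ {L j} → j < L → suc (L ∸ suc j) ≡ L ∸ j
suc-∸-suc {suc L} (s≤s j≤L) = sym (ℕP.+-∸-assoc 1 j≤L)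

next-inject₁ : ∀ {m} (i : Fin m) → next (inject₁ i) ≡ Fin.suc i
next-inject₁ {m} i with m ℕ.≟ toℕ (inject₁ i)
... | yes m≡i = ⊥-elim (FinP.toℕ-inject₁-≢ i m≡i)
... | no m≢i  = cong Fin.suc (FinP.lower₁-inject₁′ i m≢i)

next-fromℕ : ∀ m → next (fromℕ m) ≡ Fin.zero
next-fromℕ m with m ℕ.≟ toℕ (fromℕ m)
... | yes _   = refl
... | no m≢m  = ⊥-elim (m≢m (sym (FinP.toℕ-fromℕ m)))

toℕ-next : ∀ {m} (i : Fin (suc m)) →
           toℕ (next i) ≡ suc (toℕ i) ⊎ (toℕ i ≡ m × next i ≡ Fin.zero)
toℕ-next {m} i with m ℕ.≟ toℕ i
... | yes m≡i = inj₂ (sym m≡i , refl)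
... | no m≢i  = inj₁ (cong suc (FinP.toℕ-lower₁ i m≢i))

next∘next≡id⇒m≤1 : ∀ {m} (i : Fin (suc m)) → next (next i) ≡ i → m ≤ 1
next∘next≡id⇒m≤1 {m} i next²i≡i with cong toℕ next²i≡i | toℕ-next i | toℕ-next (next i)
... | eq | inj₁ p | inj₁ q = ⊥-elim (ℕP.m+1+n≢m (toℕ i) {1}
        (trans (ℕP.+-comm (toℕ i) 2) (trans (sym (trans q (cong suc p))) eq)))
... | eq | inj₁ p | inj₂ (q , r) =
        ℕP.≤-reflexive (trans (sym q) (trans p (cong suc (trans (sym eq) (cong toℕ r)))))
... | eq | inj₂ (p , q) | inj₁ r =
        ℕP.≤-reflexive (trans (sym p) (trans (sym eq) (trans r (cong (suc ∘ toℕ) q))))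
... | _  | inj₂ (p , q) | inj₂ (r , _) = subst (_≤ 1) (trans (sym (cong toℕ q)) r) z≤n

module SignedWalks (G : SignedMultigraph) where

  Joins-sym : ∀ {e x y} → Joins G e x y → Joins G e y x
  Joins-sym (inj₁ p) = inj₂ p
  Joins-sym (inj₂ p) = inj₁ p

  Joins-ends : ∀ {e a b c d} → Joins G e a b → Joins G e c d →
               (a ≡ c × b ≡ d) ⊎ (a ≡ d × b ≡ c)
  Joins-ends (inj₁ p) (inj₁ q) = inj₁ (cong proj₁ (trans (sym p) q) , cong proj₂ (trans (sym p) q))
  Joins-ends (inj₁ p) (inj₂ q) = inj₂ (cong proj₁ (trans (sym p) q) , cong proj₂ (trans (sym p) q))
  Joins-ends (inj₂ p) (inj₁ q) = inj₂ (cong proj₂ (trans (sym p) q) , cong proj₁ (trans (sym p) q))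
  Joins-ends (inj₂ p) (inj₂ q) = inj₁ (cong proj₂ (trans (sym p) q) , cong proj₁ (trans (sym p) q))

  data Walk : V G → V G → Set where
    []   : ∀ {x} → Walk x x
    cons : ∀ {x y z} (e : E G) → Joins G e x y → Walk y z → Walk x z

  length : ∀ {x y} → Walk x y → ℕ
  length []           = 0
  length (cons _ _ W) = suc (length W)

  sign : ∀ {x y} → Walk x y → Bool
  sign []           = false
  sign (cons e _ W) = neg G e xor sign W

  infixr 5 _++_
  _++_ : ∀ {x y z} → Walk x y → Walk y z → Walk x z
  []           ++ W′ = W′
  cons e j W   ++ W′ = cons e j (W ++ W′)

  length-++ : ∀ {x y z} (W : Walk x y) (W′ : Walk y z) → length (W ++ W′) ≡ length W + length W′
  length-++ []           W′ = refl
  length-++ (cons e j W) W′ = cong suc (length-++ W W′)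

  sign-++ : ∀ {x y z} (W : Walk x y) (W′ : Walk y z) → sign (W ++ W′) ≡ sign W xor sign W′
  sign-++ []           W′ = refl
  sign-++ (cons e j W) W′ = trans (cong (neg G e xor_) (sign-++ W W′)) (sym (xor-assoc (neg G e) (sign W) (sign W′)))

  reverse : ∀ {x y} → Walk x y → Walk y x
  reverse []           = []
  reverse (cons e j W) = reverse W ++ cons e (Joins-sym j) []

  length-reverse : ∀ {x y} (W : Walk x y) → length (reverse W) ≡ length W
  length-reverse []           = refl
  length-reverse (cons e j W) =
    trans (length-++ (reverse W) _) (trans (ℕP.+-comm (length (reverse W)) 1) (cong suc (length-reverse W)))

  sign-reverse : ∀ {x y} (W : Walk x y) → sign (reverse W) ≡ sign W
  sign-reverse []           = refl
  sign-reverse (cons e j W) = trans (sign-++ (reverse W) _)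
    (trans (cong₂ _xor_ (sign-reverse W) (xor-identityʳ (neg G e))) (xor-comm (sign W) (neg G e)))

  length-substʳ : ∀ {x y y′} (eq : y ≡ y′) (W : Walk x y) → length (subst (Walk x) eq W) ≡ length W
  length-substʳ refl W = refl

  sign-substʳ : ∀ {x y y′} (eq : y ≡ y′) (W : Walk x y) → sign (subst (Walk x) eq W) ≡ sign W
  sign-substʳ refl W = refl

  length-substˡ : ∀ {x x′ y} (eq : x ≡ x′) (W : Walk x y) → length (subst (λ v → Walk v y) eq W) ≡ length W
  length-substˡ refl W = refl

  sign-substˡ : ∀ {x x′ y} (eq : x ≡ x′) (W : Walk x y) → sign (subst (λ v → Walk v y) eq W) ≡ sign W
  sign-substˡ refl W = refl

  vertex : ∀ {x y} → Walk x y → ℕ → V G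
  vertex {x} W            zero    = x
  vertex {x} []           (suc p) = x
  vertex     (cons _ _ W) (suc p) = vertex W p

  vertex-length : ∀ {x y} (W : Walk x y) → vertex W (length W) ≡ y
  vertex-length []           = refl
  vertex-length (cons e j W) = vertex-length W

  vertex-++ˡ : ∀ {x y z} (W : Walk x y) (W′ : Walk y z) {p} → p ≤ length W → vertex (W ++ W′) p ≡ vertex W p
  vertex-++ˡ W            W′ {zero}  _         = refl
  vertex-++ˡ (cons e j W) W′ {suc p} (s≤s p≤l) = vertex-++ˡ W W′ p≤l

  edge : ∀ {x y} (W : Walk x y) → Fin (length W) → E G
  edge (cons e j W) Fin.zero    = e
  edge (cons e j W) (Fin.suc i) = edge W i

  joins-edge : ∀ {x y} (W : Walk x y) (i : Fin (length W)) →
               Joins G (edge W i) (vertex W (toℕ i)) (vertex W (suc (toℕ i)))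
  joins-edge (cons e j [])             Fin.zero    = j
  joins-edge (cons e j (cons _ _ _))   Fin.zero    = j
  joins-edge (cons e j W)              (Fin.suc i) = joins-edge W i

  sign≡signProd : ∀ {x y} (W : Walk x y) → sign W ≡ signProd (length W) (λ i → neg G (edge W i))
  sign≡signProd []           = refl
  sign≡signProd (cons e j W) = cong (neg G e xor_) (sign≡signProd W)

  take : ∀ {x y} (p : ℕ) (W : Walk x y) → Walk x (vertex W p)
  take zero    W            = []
  take (suc p) []           = []
  take (suc p) (cons e j W) = cons e j (take p W)

  drop : ∀ {x y} (p : ℕ) (W : Walk x y) → Walk (vertex W p) y
  drop zero    W            = W
  drop (suc p) []           = []
  drop (suc p) (cons e j W) = drop p W

  take-++-drop : ∀ {x y} (p : ℕ) (W : Walk x y) → take p W ++ drop p W ≡ W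
  take-++-drop zero    W            = refl
  take-++-drop (suc p) []           = refl
  take-++-drop (suc p) (cons e j W) = cong (cons e j) (take-++-drop p W)

  length-take : ∀ {x y} {p} (W : Walk x y) → p ≤ length W → length (take p W) ≡ p
  length-take {p = zero}  W            _         = refl
  length-take {p = suc p} (cons e j W) (s≤s p≤l) = cong suc (length-take W p≤l)

  length-drop : ∀ {x y} (p : ℕ) (W : Walk x y) → length (drop p W) ≡ length W ∸ p
  length-drop zero    W            = refl
  length-drop (suc p) []           = refl
  length-drop (suc p) (cons e j W) = length-drop p W

  vertex-drop : ∀ {x y} (p q : ℕ) (W : Walk x y) → vertex (drop p W) q ≡ vertex W (p + q)
  vertex-drop zero    q       W            = refl
  vertex-drop (suc p) zero    []           = refl
  vertex-drop (suc p) (suc q) []           = refl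
  vertex-drop (suc p) q       (cons e j W) = vertex-drop p q W

  length-take+drop : ∀ {x y} (p : ℕ) (W : Walk x y) → length (take p W) + length (drop p W) ≡ length W
  length-take+drop p W = trans (sym (length-++ (take p W) (drop p W))) (cong length (take-++-drop p W))

  sign-take+drop : ∀ {x y} (p : ℕ) (W : Walk x y) → sign (take p W) xor sign (drop p W) ≡ sign W
  sign-take+drop p W = trans (sym (sign-++ (take p W) (drop p W))) (cong sign (take-++-drop p W))

  rotate : ∀ {x} (p : ℕ) (W : Walk x x) → Walk (vertex W p) (vertex W p)
  rotate p W = drop p W ++ take p W

  length-rotate : ∀ {x} (p : ℕ) (W : Walk x x) → length (rotate p W) ≡ length W
  length-rotate p W = trans (length-++ (drop p W) (take p W))
    (trans (ℕP.+-comm (length (drop p W)) _) (length-take+drop p W))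

  sign-rotate : ∀ {x} (p : ℕ) (W : Walk x x) → sign (rotate p W) ≡ sign W
  sign-rotate p W = trans (sign-++ (drop p W) (take p W))
    (trans (xor-comm (sign (drop p W)) _) (sign-take+drop p W))

  path : ∀ ℓ (v : Fin (suc ℓ) → V G) (e : Fin ℓ → E G) →
         (∀ i → Joins G (e i) (v (inject₁ i)) (v (Fin.suc i))) → Walk (v Fin.zero) (v (fromℕ ℓ))
  path zero    v e J = []
  path (suc ℓ) v e J = cons (e Fin.zero) (J Fin.zero) (path ℓ (v ∘ Fin.suc) (e ∘ Fin.suc) (J ∘ Fin.suc))

  length-path : ∀ ℓ v e J → length (path ℓ v e J) ≡ ℓ
  length-path zero    v e J = refl
  length-path (suc ℓ) v e J = cong suc (length-path ℓ (v ∘ Fin.suc) (e ∘ Fin.suc) (J ∘ Fin.suc))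

  sign-path : ∀ ℓ v e J → sign (path ℓ v e J) ≡ signProd ℓ (neg G ∘ e)
  sign-path zero    v e J = refl
  sign-path (suc ℓ) v e J = cong (neg G (e Fin.zero) xor_) (sign-path ℓ (v ∘ Fin.suc) (e ∘ Fin.suc) (J ∘ Fin.suc))

  negCycle⇒closedWalk : ∀ {ℓ} → NegCycle G ℓ →
                        Σ (V G) λ x → Σ (Walk x x) λ W → length W ≡ ℓ × sign W ≡ true
  negCycle⇒closedWalk {suc m} c =
    vs Fin.zero , subst (Walk (vs Fin.zero)) closes W ,
    trans (length-substʳ closes W) (length-path (suc m) v es J) ,
    trans (sign-substʳ closes W) (trans (sign-path (suc m) v es J) negative)
    where
      open NegCycle′ c
      v : Fin (suc (suc m)) → V G
      v Fin.zero    = vs Fin.zero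
      v (Fin.suc i) = vs (next i)
      v-inject₁ : ∀ i → v (inject₁ i) ≡ vs i
      v-inject₁ Fin.zero    = refl
      v-inject₁ (Fin.suc i) = cong vs (next-inject₁ i)
      J : ∀ i → Joins G (es i) (v (inject₁ i)) (v (Fin.suc i))
      J i = subst (λ a → Joins G (es i) a (vs (next i))) (sym (v-inject₁ i)) (joins i)
      W = path (suc m) v es J
      closes : vs (next (fromℕ m)) ≡ vs Fin.zero
      closes = cong vs (next-fromℕ m)

  sign-repeated-edge : ∀ {x} (W : Walk x x) (i i′ : Fin (length W)) → length W ≤ 2 →
                       i ≢ i′ → edge W i ≡ edge W i′ → sign W ≡ false
  sign-repeated-edge (cons e j [])              Fin.zero Fin.zero _ i≢i′ _ = ⊥-elim (i≢i′ refl)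
  sign-repeated-edge (cons e j (cons _ _ []))   Fin.zero Fin.zero _ i≢i′ _ = ⊥-elim (i≢i′ refl)
  sign-repeated-edge (cons e j (cons _ _ []))   Fin.zero (Fin.suc Fin.zero) _ _ refl =
    trans (cong (neg G e xor_) (xor-identityʳ (neg G e))) (xor-same (neg G e))
  sign-repeated-edge (cons e j (cons e′ _ []))  (Fin.suc Fin.zero) Fin.zero _ _ refl =
    trans (cong (neg G e′ xor_) (xor-identityʳ (neg G e′))) (xor-same (neg G e′))
  sign-repeated-edge (cons e j (cons _ _ []))   (Fin.suc Fin.zero) (Fin.suc Fin.zero) _ i≢i′ _ = ⊥-elim (i≢i′ refl)
  sign-repeated-edge (cons _ _ (cons _ _ (cons _ _ _))) _ _ (s≤s (s≤s ()))

  simpleClosedWalk⇒negCycle : ∀ {x y} e (j : Joins G e x y) (W : Walk y x) →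
    Injective _≡_ _≡_ (λ (i : Fin (suc (length W))) → vertex (cons e j W) (toℕ i)) →
    sign (cons e j W) ≡ true → NegCycle′ G (length W)
  simpleClosedWalk⇒negCycle e j W vs-inj negative = record
    { vs = vs ; es = edge C ; vs-inj = vs-inj ; es-inj = es-inj ; joins = joins
    ; negative = trans (sym (sign≡signProd C)) negative }
    where
      C = cons e j W
      vs = λ (i : Fin (suc (length W))) → vertex C (toℕ i)
      vertex-suc : ∀ i → vertex C (suc (toℕ i)) ≡ vs (next i)
      vertex-suc i with toℕ-next i
      ... | inj₁ p       = cong (vertex C) (sym p)
      ... | inj₂ (p , q) = trans (cong (vertex C ∘ suc) p) (trans (vertex-length C) (cong vs (sym q)))
      joins : ∀ i → Joins G (edge C i) (vs i) (vs (next i))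
      joins i = subst (Joins G (edge C i) (vs i)) (vertex-suc i) (joins-edge C i)
      es-inj : Injective _≡_ _≡_ (edge C)
      es-inj {i} {i′} eq with i Fin.≟ i′
      ... | yes i≡i′ = i≡i′
      ... | no i≢i′ with Joins-ends (joins i) (subst (λ d → Joins G d (vs i′) (vs (next i′))) (sym eq) (joins i′))
      ...   | inj₁ (p , _) = vs-inj p
      ...   | inj₂ (p , q) = ⊥-elim (not-¬ negative (sign-repeated-edge C i i′ (s≤s m≤1) i≢i′ eq))
        -- the walk runs back and forth along one edge
        where m≤1 = next∘next≡id⇒m≤1 i (trans (cong next (vs-inj q)) (sym (vs-inj p)))

  shorterNegClosedWalk : ∀ {x} (W : Walk x x) → sign W ≡ true → ∀ {p r} → p < r → r < length W →
    vertex W p ≡ vertex W r → Σ (V G) λ a → Σ (Walk a a) λ W′ → length W′ < length W × sign W′ ≡ true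
  shorterNegClosedWalk W negative {p} {r} p<r r<l repeat =
    choose (xor≡true _ _ (trans (sign-take+drop q R) (trans (sign-rotate p W) negative)))
    where
      a = vertex W p
      R = rotate p W
      q = r ∸ p
      q≤R : q ≤ length R
      q≤R = subst (q ≤_) (sym (length-rotate p W)) (ℕP.≤-trans (ℕP.m∸n≤m r p) (ℕP.<⇒≤ r<l))
      back : vertex R q ≡ a
      back = begin
        vertex (drop p W ++ take p W) q ≡⟨ vertex-++ˡ (drop p W) (take p W)
                                             (subst (q ≤_) (sym (length-drop p W)) (ℕP.∸-monoˡ-≤ p (ℕP.<⇒≤ r<l))) ⟩
        vertex (drop p W) q             ≡⟨ vertex-drop p q W ⟩
        vertex W (p + q)                ≡⟨ cong (vertex W) (ℕP.m+[n∸m]≡n (ℕP.<⇒≤ p<r)) ⟩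
        vertex W r                      ≡⟨ sym repeat ⟩
        a                               ∎
        where open ≡-Reasoning
      length-loop : length (take q R) ≡ q
      length-loop = length-take R q≤R
      choose : sign (take q R) ≡ true ⊎ sign (drop q R) ≡ true →
               Σ (V G) λ a → Σ (Walk a a) λ W′ → length W′ < length W × sign W′ ≡ true
      choose (inj₁ neg-loop) = a , subst (Walk a) back (take q R) ,
        subst (_< length W) (sym (trans (length-substʳ back _) length-loop)) (ℕP.≤-<-trans (ℕP.m∸n≤m r p) r<l) ,
        trans (sign-substʳ back _) neg-loop
      choose (inj₂ neg-rest) = a , subst (λ v → Walk v a) back (drop q R) ,
        subst (_< length W) (sym (trans (length-substˡ back _) (trans (length-drop q R) (cong (_∸ q) (length-rotate p W)))))
          (ℕP.∸-monoʳ-< (ℕP.m<n⇒0<n∸m p<r) (ℕP.≤-trans (ℕP.m∸n≤m r p) (ℕP.<⇒≤ r<l))) ,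
        trans (sign-substˡ back _) neg-rest

  noShortNegClosedWalk⇒noShortNegCycle : ∀ {g} → (∀ {x} (W : Walk x x) → length W < g → sign W ≡ false) →
                                         ∀ ℓ → ℓ < g → ¬ NegCycle G ℓ
  noShortNegClosedWalk⇒noShortNegCycle short ℓ ℓ<g c with negCycle⇒closedWalk c
  ... | x , W , length≡ , negative = not-¬ negative (short W (subst (_< _) (sym length≡) ℓ<g))

  module _ (_≟_ : DecidableEquality (V G)) where

    injective-or-repeat : ∀ {L} (f : Fin L → V G) →
                          Injective _≡_ _≡_ f ⊎ (∃₂ λ i j → toℕ i < toℕ j × f i ≡ f j)
    injective-or-repeat f with FinP.any? (λ i → FinP.any? (λ j → (toℕ i ℕ.<? toℕ j) ×-dec (f i ≟ f j)))
    ... | yes (i , j , r) = inj₂ (i , j , r)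
    ... | no no-repeat    = inj₁ injective
      where
        injective : Injective _≡_ _≡_ f
        injective {i} {j} eq with FinP.<-cmp i j
        ... | tri< i<j _ _   = ⊥-elim (no-repeat (i , j , i<j , eq))
        ... | tri≈ _ i≡j _   = i≡j
        ... | tri> _ _ j<i   = ⊥-elim (no-repeat (j , i , j<i , sym eq))

    negClosedWalk⇒negCycle : ∀ {x} (W : Walk x x) → sign W ≡ true →
                             Σ ℕ λ m → suc m ≤ length W × NegCycle′ G m
    negClosedWalk⇒negCycle W = go (length W) W ℕP.≤-refl
      where
        go : ∀ N {x} (W : Walk x x) → length W ≤ N → sign W ≡ true →
             Σ ℕ λ m → suc m ≤ length W × NegCycle′ G m
        go N       []             _   ()
        go zero    (cons _ _ _)   ()  _
        go (suc N) W@(cons e j W′) (s≤s W′≤N) negative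
          with injective-or-repeat (λ (i : Fin (suc (length W′))) → vertex W (toℕ i))
        ... | inj₁ simple = length W′ , ℕP.≤-refl , simpleClosedWalk⇒negCycle e j W′ simple negative
        ... | inj₂ (i , i′ , i<i′ , repeat)
          with shorterNegClosedWalk W negative i<i′ (FinP.toℕ<n i′) repeat
        ...   | _ , W″ , shorter , negative″ with go N W″ (ℕP.≤-trans (ℕ.s≤s⁻¹ shorter) W′≤N) negative″
        ...     | m , m<W″ , c = m , ℕP.≤-trans m<W″ (ℕP.<⇒≤ shorter) , c

    noShortNegCycle⇒noShortNegClosedWalk : ∀ {g} → (∀ ℓ → ℓ < g → ¬ NegCycle G ℓ) →
                                           ∀ {x} (W : Walk x x) → length W < g → sign W ≡ false
    noShortNegCycle⇒noShortNegClosedWalk short W W<g with sign W in s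
    ... | false = refl
    ... | true with negClosedWalk⇒negCycle W s
    ...   | m , m<W , c = ⊥-elim (short (suc m) (ℕP.≤-<-trans m<W W<g) c)

    negCycle-of-girth : ∀ {g x} → (∀ ℓ → ℓ < g → ¬ NegCycle G ℓ) →
                        (W : Walk x x) → length W ≡ g → sign W ≡ true → NegCycle G g
    negCycle-of-girth {g} short W length≡g negative with negClosedWalk⇒negCycle W negative
    ... | m , m<W , c with suc m ℕ.<? g
    ...   | yes m<g = ⊥-elim (short (suc m) m<g c)
    ...   | no m≮g  = subst (NegCycle G) (ℕP.≤-antisym (subst (suc m ≤_) length≡g m<W) (ℕP.≮⇒≥ m≮g)) c

pathLength : ℕ → Bool → ℤ → ℕ
pathLength k true  z = ∣ z ∣
pathLength k false z = 2 * k ∸ ∣ z ∣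

pathSign : Bool → ℤ → Bool
pathSign true  z = ⌊ z ℤ.<? ℤ.0ℤ ⌋
pathSign false z = not ⌊ z ℤ.<? ℤ.0ℤ ⌋

pathLength-complement : ∀ k b {z} → ∣ z ∣ ≤ k → pathLength k b z + pathLength k (not b) z ≡ 2 * k
pathLength-complement k true  z≤k = ℕP.m+[n∸m]≡n (ℕP.≤-trans z≤k (ℕP.m≤m+n k (k + 0)))
pathLength-complement k false {z} z≤k =
  trans (ℕP.+-comm (2 * k ∸ ∣ z ∣) _) (ℕP.m+[n∸m]≡n (ℕP.≤-trans z≤k (ℕP.m≤m+n k (k + 0))))

pathSign-not : ∀ b z → pathSign (not b) z ≡ not (pathSign b z)
pathSign-not true  z = refl
pathSign-not false z = sym (not-involutive _)

pathSign-onto : ∀ s z → Σ Bool λ b → pathSign b z ≡ s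
pathSign-onto s z with ⌊ z ℤ.<? ℤ.0ℤ ⌋ in neg
... | true  = s , onto s
  where onto : ∀ s → pathSign s z ≡ s
        onto true  = neg
        onto false = cong not neg
... | false = not s , onto s
  where onto : ∀ s → pathSign (not s) z ≡ s
        onto true  = cong not neg
        onto false = neg

1≤pathLength : ∀ {k} b {z} → 1 ≤ k → not ⌊ z ℤ.≟ ℤ.0ℤ ⌋ ≡ true → ∣ z ∣ ≤ k → 1 ≤ pathLength k b z
1≤pathLength true  {z = ℤ.+ zero}  _ () _
1≤pathLength true  {z = ℤ.+ suc _} _ _  _ = s≤s z≤n
1≤pathLength true  {z = -[1+ _ ]}  _ _  _ = s≤s z≤n
1≤pathLength {k} false {z} 1≤k _ z≤k =
  ℕP.≤-trans 1≤k (ℕP.≤-trans (ℕP.≤-reflexive (sym 2k∸k≡k)) (ℕP.∸-monoʳ-≤ (2 * k) z≤k))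
  where 2k∸k≡k : 2 * k ∸ k ≡ k
        2k∸k≡k = trans (ℕP.m+n∸m≡n k (k + 0)) (ℕP.+-identityʳ k)

adj-cong : ∀ {m n} (w : WGraph m) (w′ : WGraph n) {x y x′ y′} → w x y ≡ w′ x′ y′ → adj w x y ≡ adj w′ x′ y′
adj-cong w w′ = cong (λ z → not ⌊ z ℤ.≟ ℤ.0ℤ ⌋)

adj-sym : ∀ {n} (w : WGraph n) → (∀ x y → w x y ≡ w y x) → ∀ x y → adj w x y ≡ adj w y x
adj-sym w w-sym x y = adj-cong w w (w-sym x y)

adj-irrefl : ∀ {n} (w : WGraph n) → (∀ x → w x x ≡ ℤ.0ℤ) → ∀ x → adj w x x ≡ false
adj-irrefl w w-diag x = cong (λ z → not ⌊ z ℤ.≟ ℤ.0ℤ ⌋) (w-diag x)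

module DoubleGraph (k : ℕ) {n : ℕ} (w : WGraph n) where
  open Double k w public
  open SignedWalks graph public

  len≡pathLength : ∀ e p → len e p ≡ pathLength k p (wt e)
  len≡pathLength e true  = refl
  len≡pathLength e false = refl

  pathNeg≡pathSign : ∀ e p → pathNeg e p ≡ pathSign p (wt e)
  pathNeg≡pathSign e true  = refl
  pathNeg≡pathSign e false = refl

  dneg≡isZero∧pathNeg : ∀ e p j t → dneg (e , p , j , t) ≡ isZero j ∧ pathNeg e p
  dneg≡isZero∧pathNeg e p zero    t = refl
  dneg≡isZero∧pathNeg e p (suc j) t = refl

  mkEdge : ∀ a b → toℕ a < toℕ b → adj w a b ≡ true → Edge
  mkEdge a b a<b ab = (a , b) , Equivalence.from T-∧ (ℕP.<⇒<ᵇ a<b , subst T (sym ab) tt)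

  src<tgt : ∀ e → toℕ (src e) < toℕ (tgt e)
  src<tgt ((a , b) , t) = ℕP.<ᵇ⇒< (toℕ a) (toℕ b) (proj₁ (Equivalence.to T-∧ t))

  adj-src-tgt : ∀ e → adj w (src e) (tgt e) ≡ true
  adj-src-tgt ((a , b) , t) = Equivalence.to T-≡ (proj₂ (Equivalence.to T-∧ t))

  Edge-≡ : ∀ {e e′ : Edge} → src e ≡ src e′ → tgt e ≡ tgt e′ → e ≡ e′
  Edge-≡ {(a , b) , t} {(.a , .b) , t′} refl refl = cong ((a , b) ,_) (T-irrelevant t t′)

  _≟ᵉ_ : DecidableEquality Edge
  _≟ᵉ_ = ProductP.≡-dec (ProductP.≡-dec FinP._≟_ FinP._≟_) (λ t t′ → yes (T-irrelevant t t′))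

  _≟ᵛ_ : DecidableEquality Vert
  _≟ᵛ_ = SumP.≡-dec FinP._≟_ (ProductP.≡-dec _≟ᵉ_ (ProductP.≡-dec Bool._≟_
           (ProductP.≡-dec ℕ._≟_ (λ t t′ → yes (T-irrelevant t t′)))))

  vertexAt-inner : ∀ e p i (t : T (suc i <ᵇ len e p)) → vertexAt e p (suc i) ≡ inj₂ (e , p , i , t)
  vertexAt-inner e p i t with T? (suc i <ᵇ len e p)
  ... | yes t′ = cong (λ t → inj₂ (e , p , i , t)) (T-irrelevant t′ t)
  ... | no ¬t  = ⊥-elim (¬t t)

  endpoint-vertexAt : ∀ e p j t {v z} → Joins graph (e , p , j , t) v z →
                      v ≡ vertexAt e p j ⊎ v ≡ vertexAt e p (suc j)
  endpoint-vertexAt e p j t (inj₁ eq) = inj₁ (sym (cong proj₁ eq))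
  endpoint-vertexAt e p j t (inj₂ eq) = inj₂ (sym (cong proj₂ eq))

  vertexAt-end : ∀ e p j → len e p ≤ j → 1 ≤ j → vertexAt e p j ≡ inj₁ (tgt e)
  vertexAt-end e p (suc i) len≤j _ with T? (suc i <ᵇ len e p)
  ... | yes t = ⊥-elim (ℕP.<⇒≱ (ℕP.<ᵇ⇒< (suc i) (len e p) t) len≤j)
  ... | no _  = refl

  gadgetFrom : ∀ e p j r → j + r ≡ len e p → Walk (vertexAt e p j) (vertexAt e p (len e p))
  gadgetFrom e p j zero    j≡len =
    subst (Walk (vertexAt e p j)) (cong (vertexAt e p) (trans (sym (ℕP.+-identityʳ j)) j≡len)) []
  gadgetFrom e p j (suc r) j+r≡len =
    cons (e , p , j , ℕP.<⇒<ᵇ (subst (j <_) j+r≡len (ℕP.m<m+n j (s≤s z≤n)))) (inj₁ refl)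
         (gadgetFrom e p (suc j) r (trans (sym (ℕP.+-suc j r)) j+r≡len))

  length-gadgetFrom : ∀ e p j r eq → length (gadgetFrom e p j r eq) ≡ r
  length-gadgetFrom e p j zero    eq = length-substʳ _ []
  length-gadgetFrom e p j (suc r) eq = cong suc (length-gadgetFrom e p (suc j) r _)

  sign-gadgetFrom-suc : ∀ e p j r eq → sign (gadgetFrom e p (suc j) r eq) ≡ false
  sign-gadgetFrom-suc e p j zero    eq = sign-substʳ (cong (vertexAt e p) (trans (sym (ℕP.+-identityʳ (suc j))) eq)) []
  sign-gadgetFrom-suc e p j (suc r) eq = sign-gadgetFrom-suc e p (suc j) r _

  sign-gadgetFrom : ∀ e p r eq → 1 ≤ r → sign (gadgetFrom e p 0 r eq) ≡ pathNeg e p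
  sign-gadgetFrom e p (suc r) eq _ = trans (cong (pathNeg e p xor_) (sign-gadgetFrom-suc e p 0 r _)) (xor-identityʳ _)

  gadget : ∀ e p → 1 ≤ len e p →
    Σ (Walk (inj₁ (src e)) (inj₁ (tgt e))) λ W → length W ≡ pathLength k p (wt e) × sign W ≡ pathSign p (wt e)
  gadget e p 1≤len =
    subst (Walk _) closes W ,
    trans (length-substʳ closes W) (trans (length-gadgetFrom e p 0 _ refl) (len≡pathLength e p)) ,
    trans (sign-substʳ closes W) (trans (sign-gadgetFrom e p _ refl 1≤len) (pathNeg≡pathSign e p))
    where
      W = gadgetFrom e p 0 (len e p) refl
      closes = vertexAt-end e p (len e p) ℕP.≤-refl 1≤len

  module _ (isW : IsWGraph w) (1≤k : 1 ≤ k) where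

    gadgetOf : ∀ e b → ∣ wt e ∣ ≤ k →
      Σ (Walk (inj₁ (src e)) (inj₁ (tgt e))) λ W → length W ≡ pathLength k b (wt e) × sign W ≡ pathSign b (wt e)
    gadgetOf e b bounded =
      gadget e b (subst (1 ≤_) (sym (len≡pathLength e b)) (1≤pathLength b 1≤k (adj-src-tgt e) bounded))

    gadgetBetween : ∀ x y → adj w x y ≡ true → ∣ w x y ∣ ≤ k → ∀ b →
      Σ (Walk (inj₁ x) (inj₁ y)) λ W → length W ≡ pathLength k b (w x y) × sign W ≡ pathSign b (w x y)
    gadgetBetween x y xy bounded b with FinP.<-cmp x y
    ... | tri< x<y _ _ = gadgetOf (mkEdge x y x<y xy) b bounded
    ... | tri≈ _ refl _ = ⊥-elim (not-¬ refl (trans (sym xy) (adj-irrefl w (proj₂ isW) x)))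
    ... | tri> _ _ y<x with gadgetOf (mkEdge y x y<x (trans (adj-sym w (proj₁ isW) y x) xy)) b
                                     (subst (λ z → ∣ z ∣ ≤ k) (proj₁ isW x y) bounded)
    ...   | W , length≡ , sign≡ =
            reverse W , trans (length-reverse W) (trans length≡ (cong (pathLength k b) yx≡xy)) ,
            trans (sign-reverse W) (trans sign≡ (cong (pathSign b) yx≡xy))
      where yx≡xy = proj₁ isW y x

    module _ (wide : Wide k w) where

      noShortNegClosedWalk : ∀ {x} (W : Walk x x) → length W < 2 * k → sign W ≡ false
      noShortNegClosedWalk = noShortNegCycle⇒noShortNegClosedWalk _≟ᵛ_ (proj₂ (proj₂ wide))

      shortWalk-dominates-gadget : ∀ {x y} → adj w x y ≡ true → (Q : Walk (inj₁ x) (inj₁ y)) → length Q < 2 * k →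
        Σ Bool λ b → pathLength k b (w x y) ≤ length Q × pathSign b (w x y) ≡ sign Q
      shortWalk-dominates-gadget {x} {y} xy Q Q<2k = b , gadget≤Q , sign≡
        -- Q followed by the gadget path of the other sign is a negative closed walk, hence has
        -- length at least 2k, and the two gadget paths have total length 2k.
        where
          z = w x y
          bounded = proj₁ wide x y xy
          b = proj₁ (pathSign-onto (sign Q) z)
          sign≡ = proj₂ (pathSign-onto (sign Q) z)
          P = gadgetBetween x y xy bounded (not b)
          closed = Q ++ reverse (proj₁ P)
          negative : sign closed ≡ true
          negative = begin
            sign (Q ++ reverse (proj₁ P))        ≡⟨ sign-++ Q _ ⟩
            sign Q xor sign (reverse (proj₁ P))  ≡⟨ cong (sign Q xor_) (trans (sign-reverse (proj₁ P)) (proj₂ (proj₂ P))) ⟩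
            sign Q xor pathSign (not b) z        ≡⟨ cong (sign Q xor_) (trans (pathSign-not b z) (cong not sign≡)) ⟩
            sign Q xor not (sign Q)              ≡⟨ xor-inverseʳ (sign Q) ⟩
            true                                 ∎
            where open ≡-Reasoning
          length-closed : length closed ≡ length Q + pathLength k (not b) z
          length-closed = trans (length-++ Q _) (cong (length Q +_) (trans (length-reverse (proj₁ P)) (proj₁ (proj₂ P))))
          2k≤closed : 2 * k ≤ length Q + pathLength k (not b) z
          2k≤closed = subst (2 * k ≤_) length-closed
            (ℕP.≮⇒≥ λ closed<2k → not-¬ (noShortNegClosedWalk closed closed<2k) negative)
          gadget≤Q : pathLength k b z ≤ length Q
          gadget≤Q = ℕP.+-cancelʳ-≤ (pathLength k (not b) z) _ _
            (subst (_≤ length Q + pathLength k (not b) z) (sym (pathLength-complement k b bounded)) 2k≤closed)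

module Embedding (k : ℕ) {m n : ℕ} (w : WGraph m) (w′ : WGraph n) (f : Fin m → Fin n)
                 (f-injective : Injective _≡_ _≡_ f) (w′∘f≡w : ∀ i j → w′ (f i) (f j) ≡ w i j)
                 (w′-sym : ∀ i j → w′ i j ≡ w′ j i) where
  module D  = DoubleGraph k w
  module D′ = DoubleGraph k w′

  data Orientation (e : D.Edge) : Set where
    forward  : toℕ (f (D.src e)) < toℕ (f (D.tgt e)) → Orientation e
    backward : toℕ (f (D.tgt e)) < toℕ (f (D.src e)) → Orientation e

  orientation : ∀ e → Orientation e
  orientation e with ℕP.<-cmp (toℕ (f (D.src e))) (toℕ (f (D.tgt e)))
  ... | tri< s<t _ _ = forward s<t
  ... | tri> _ _ t<s = backward t<s
  ... | tri≈ _ s≡t _ = ⊥-elim (ℕP.<-irrefl (cong toℕ (f-injective (FinP.toℕ-injective s≡t))) (D.src<tgt e))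

  adj-f : ∀ a b → adj w′ (f a) (f b) ≡ adj w a b
  adj-f a b = adj-cong w′ w (w′∘f≡w a b)

  ιEdge′ : ∀ e → Orientation e → D′.Edge
  ιEdge′ e (forward s<t)  = D′.mkEdge (f (D.src e)) (f (D.tgt e)) s<t (trans (adj-f _ _) (D.adj-src-tgt e))
  ιEdge′ e (backward t<s) = D′.mkEdge (f (D.tgt e)) (f (D.src e)) t<s
                              (trans (adj-sym w′ w′-sym _ _) (trans (adj-f _ _) (D.adj-src-tgt e)))

  ιEdge : D.Edge → D′.Edge
  ιEdge e = ιEdge′ e (orientation e)

  wt-ιEdge′ : ∀ e o → D′.wt (ιEdge′ e o) ≡ D.wt e
  wt-ιEdge′ e (forward _)  = w′∘f≡w _ _
  wt-ιEdge′ e (backward _) = trans (w′-sym _ _) (w′∘f≡w _ _)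

  len-ιEdge′ : ∀ e o p → D′.len (ιEdge′ e o) p ≡ D.len e p
  len-ιEdge′ e o true  = cong ∣_∣ (wt-ιEdge′ e o)
  len-ιEdge′ e o false = cong (λ z → 2 * k ∸ ∣ z ∣) (wt-ιEdge′ e o)

  pathNeg-ιEdge′ : ∀ e o p → D′.pathNeg (ιEdge′ e o) p ≡ D.pathNeg e p
  pathNeg-ιEdge′ e o true  = cong (pathSign true) (wt-ιEdge′ e o)
  pathNeg-ιEdge′ e o false = cong (pathSign false) (wt-ιEdge′ e o)

  reversed : ∀ {e} → Orientation e → Bool
  reversed (forward _)  = false
  reversed (backward _) = true

  -- Positions along the image path; the inner vertex with index i sits at position suc i.
  vertexPosition : ∀ {e} → Orientation e → ℕ → ℕ → ℕ
  vertexPosition (forward _)  L j = j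
  vertexPosition (backward _) L j = L ∸ j

  edgePosition : ∀ {e} → Orientation e → ℕ → ℕ → ℕ
  edgePosition (forward _)  L j = j
  edgePosition (backward _) L j = L ∸ suc j

  innerPosition : ∀ {e} → Orientation e → ℕ → ℕ → ℕ
  innerPosition (forward _)  L i = i
  innerPosition (backward _) L i = L ∸ suc (suc i)

  ι : D.Vert → D′.Vert
  ι (inj₁ v)               = inj₁ (f v)
  ι (inj₂ (e , p , i , _)) = D′.vertexAt (ιEdge e) p (vertexPosition (orientation e) (D.len e p) (suc i))

  -- ι preserves signs only up to switching: reversing a negative gadget path moves its
  -- sign from the first edge to the last, which is undone by switching its inner vertices.
  switching : D.Vert → Bool
  switching (inj₁ v)               = false
  switching (inj₂ (e , p , _ , _)) = reversed (orientation e) ∧ D.pathNeg e p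

  edgePosition< : ∀ e (o : Orientation e) p j → j < D.len e p → edgePosition o (D.len e p) j < D′.len (ιEdge′ e o) p
  edgePosition< e o@(forward _)  p j j<L = subst (j <_) (sym (len-ιEdge′ e o p)) j<L
  edgePosition< e o@(backward _) p j j<L =
    subst (D.len e p ∸ suc j <_) (sym (len-ιEdge′ e o p)) (ℕP.∸-monoʳ-< {D.len e p} {suc j} {0} (s≤s z≤n) j<L)

  ιDEdge′ : ∀ e (o : Orientation e) p j → T (j <ᵇ D.len e p) → D′.DEdge
  ιDEdge′ e o p j t = ιEdge′ e o , p , edgePosition o (D.len e p) j ,
                      ℕP.<⇒<ᵇ (edgePosition< e o p j (ℕP.<ᵇ⇒< _ _ t))

  ιDEdge : D.DEdge → D′.DEdge
  ιDEdge (e , p , j , t) = ιDEdge′ e (orientation e) p j t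

  ι-start : ∀ e (o : Orientation e) p → 1 ≤ D.len e p →
            inj₁ (f (D.src e)) ≡ D′.vertexAt (ιEdge′ e o) p (vertexPosition o (D.len e p) 0)
  ι-start e (forward _)    p _    = refl
  ι-start e o@(backward _) p 1≤L = sym (D′.vertexAt-end _ p (D.len e p) (ℕP.≤-reflexive (len-ιEdge′ e o p)) 1≤L)

  ι-end : ∀ e (o : Orientation e) p → 1 ≤ D.len e p →
          inj₁ (f (D.tgt e)) ≡ D′.vertexAt (ιEdge′ e o) p (vertexPosition o (D.len e p) (D.len e p))
  ι-end e o@(forward _)  p 1≤L = sym (D′.vertexAt-end _ p (D.len e p) (ℕP.≤-reflexive (len-ιEdge′ e o p)) 1≤L)
  ι-end e o@(backward _) p _   = cong (D′.vertexAt (ιEdge′ e o) p) (sym (ℕP.n∸n≡0 (D.len e p)))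

  ι-vertexAt : ∀ e p j → j ≤ D.len e p → 1 ≤ D.len e p →
               ι (D.vertexAt e p j) ≡ D′.vertexAt (ιEdge e) p (vertexPosition (orientation e) (D.len e p) j)
  ι-vertexAt e p zero    _   1≤L = ι-start e (orientation e) p 1≤L
  ι-vertexAt e p (suc i) j≤L 1≤L with T? (suc i <ᵇ D.len e p)
  ... | yes _ = refl
  ... | no ¬j<L = trans (ι-end e (orientation e) p 1≤L)
        (cong (λ j → D′.vertexAt (ιEdge e) p (vertexPosition (orientation e) (D.len e p) j))
              (ℕP.≤-antisym (ℕP.≮⇒≥ (λ j<L → ¬j<L (ℕP.<⇒<ᵇ j<L))) j≤L))

  switching-vertexAt : ∀ e p j →
    switching (D.vertexAt e p j) ≡ isInner j (D.len e p) ∧ (reversed (orientation e) ∧ D.pathNeg e p)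
  switching-vertexAt e p zero    = refl
  switching-vertexAt e p (suc i) with T? (suc i <ᵇ D.len e p)
  ... | yes t = cong (_∧ (reversed (orientation e) ∧ D.pathNeg e p)) (sym (<ᵇ-true (ℕP.<ᵇ⇒< (suc i) (D.len e p) t)))
  ... | no ¬t with suc i <ᵇ D.len e p
  ...   | true  = ⊥-elim (¬t tt)
  ...   | false = refl

  joins-ιDEdge′ : ∀ e (o : Orientation e) p j (t : T (j <ᵇ D.len e p)) →
    Joins D′.graph (ιDEdge′ e o p j t) (D′.vertexAt (ιEdge′ e o) p (vertexPosition o (D.len e p) j))
                                       (D′.vertexAt (ιEdge′ e o) p (vertexPosition o (D.len e p) (suc j)))
  joins-ιDEdge′ e (forward _)    p j t = inj₁ refl
  joins-ιDEdge′ e o@(backward _) p j t =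
    inj₂ (cong (λ i → D′.vertexAt (ιEdge′ e o) p (D.len e p ∸ suc j) , D′.vertexAt (ιEdge′ e o) p i)
               (suc-∸-suc (ℕP.<ᵇ⇒< j _ t)))

  joins-ιDEdge : ∀ e p j (t : T (j <ᵇ D.len e p)) →
                 Joins D′.graph (ιDEdge (e , p , j , t)) (ι (D.vertexAt e p j)) (ι (D.vertexAt e p (suc j)))
  joins-ιDEdge e p j t =
    subst₂ (Joins D′.graph (ιDEdge (e , p , j , t))) (sym (ι-vertexAt e p j (ℕP.<⇒≤ j<L) 1≤L))
           (sym (ι-vertexAt e p (suc j) j<L 1≤L)) (joins-ιDEdge′ e (orientation e) p j t)
    where j<L = ℕP.<ᵇ⇒< j _ t
          1≤L = ℕP.≤-trans (s≤s z≤n) j<L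

  sign-edgePosition : ∀ {e} (o : Orientation e) L j s → j < L →
    isZero (edgePosition o L j) ∧ s ≡
    (isZero j ∧ s) xor ((isInner j L ∧ (reversed o ∧ s)) xor (isInner (suc j) L ∧ (reversed o ∧ s)))
  sign-edgePosition (forward _) L j s _ rewrite ∧-zeroʳ (isInner j L) | ∧-zeroʳ (isInner (suc j) L) =
    sym (xor-identityʳ _)
  sign-edgePosition (backward _) L zero    s j<L rewrite isZero-∸ L zero j<L = not-∧ (1 <ᵇ L) s
  sign-edgePosition (backward _) L (suc j) s j<L rewrite isZero-∸ L (suc j) j<L | <ᵇ-true j<L =
    not-∧ (suc (suc j) <ᵇ L) s

  dneg-ιDEdge : ∀ e p j (t : T (j <ᵇ D.len e p)) →
    D′.dneg (ιDEdge (e , p , j , t)) ≡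
    D.dneg (e , p , j , t) xor (switching (D.vertexAt e p j) xor switching (D.vertexAt e p (suc j)))
  dneg-ιDEdge e p j t =
    trans (D′.dneg≡isZero∧pathNeg (ιEdge e) p _ _)
    (trans (cong (isZero (edgePosition (orientation e) (D.len e p) j) ∧_) (pathNeg-ιEdge′ e (orientation e) p))
    (trans (sign-edgePosition (orientation e) (D.len e p) j (D.pathNeg e p) (ℕP.<ᵇ⇒< j _ t))
    (sym (cong₂ _xor_ (D.dneg≡isZero∧pathNeg e p j t)
                      (cong₂ _xor_ (switching-vertexAt e p j) (switching-vertexAt e p (suc j)))))))

  ιEdge-onto : (e′ : D′.Edge) → ∀ a b → D′.src e′ ≡ f a → D′.tgt e′ ≡ f b → Σ D.Edge λ e → ιEdge e ≡ e′
  ιEdge-onto e′ a b sa tb with ℕP.<-cmp (toℕ a) (toℕ b)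
  ... | tri< a<b _ _ = e , onto (orientation e)
    where
      e = D.mkEdge a b a<b (trans (sym (adj-f a b)) (trans (sym (cong₂ (adj w′) sa tb)) (D′.adj-src-tgt e′)))
      onto : ∀ o → ιEdge′ e o ≡ e′
      onto (forward _)    = D′.Edge-≡ (sym sa) (sym tb)
      onto (backward b<a) = ⊥-elim (ℕP.<-asym b<a (subst₂ (λ x y → toℕ x < toℕ y) sa tb (D′.src<tgt e′)))
  ... | tri> _ _ b<a = e , onto (orientation e)
    where
      e = D.mkEdge b a b<a (trans (sym (adj-f b a)) (trans (adj-sym w′ w′-sym _ _)
            (trans (sym (cong₂ (adj w′) sa tb)) (D′.adj-src-tgt e′))))
      onto : ∀ o → ιEdge′ e o ≡ e′
      onto (forward a<b) = ⊥-elim (ℕP.<-asym a<b (subst₂ (λ x y → toℕ x < toℕ y) sa tb (D′.src<tgt e′)))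
      onto (backward _)  = D′.Edge-≡ (sym sa) (sym tb)
  ... | tri≈ _ a≡b _ = ⊥-elim (ℕP.<-irrefl (cong toℕ (trans sa (trans (cong f (FinP.toℕ-injective a≡b)) (sym tb))))
                                            (D′.src<tgt e′))

  DEdge-≡ : ∀ {e′ : D′.Edge} {p i j} (t : T (i <ᵇ D′.len e′ p)) (t′ : T (j <ᵇ D′.len e′ p)) → i ≡ j →
            _≡_ {A = D′.DEdge} (e′ , p , i , t) (e′ , p , j , t′)
  DEdge-≡ t t′ refl = cong (λ t → _ , _ , _ , t) (T-irrelevant t t′)

  ιDEdge′-onto : ∀ e (o : Orientation e) p j′ (t′ : T (j′ <ᵇ D′.len (ιEdge′ e o) p)) →
                 Σ ℕ λ j → Σ (T (j <ᵇ D.len e p)) λ t → ιDEdge′ e o p j t ≡ (ιEdge′ e o , p , j′ , t′)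
  ιDEdge′-onto e o@(forward _) p j′ t′ = j′ , t , DEdge-≡ _ t′ refl
    where t = subst (λ L → T (j′ <ᵇ L)) (len-ιEdge′ e o p) t′
  ιDEdge′-onto e o@(backward _) p j′ t′ = L ∸ suc j′ , ℕP.<⇒<ᵇ j<L , DEdge-≡ _ t′ position
    where
      L = D.len e p
      j′<L : j′ < L
      j′<L = subst (j′ <_) (len-ιEdge′ e o p) (ℕP.<ᵇ⇒< j′ _ t′)
      j<L : L ∸ suc j′ < L
      j<L = ℕP.∸-monoʳ-< {L} {suc j′} {0} (s≤s z≤n) j′<L
      position : L ∸ suc (L ∸ suc j′) ≡ j′
      position = trans (cong (L ∸_) (suc-∸-suc j′<L)) (ℕP.m∸[m∸n]≡n (ℕP.<⇒≤ j′<L))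

  ιDEdge-onto : (d′ : D′.DEdge) → ∀ a b → D′.src (proj₁ d′) ≡ f a → D′.tgt (proj₁ d′) ≡ f b →
                Σ D.DEdge λ d → ιDEdge d ≡ d′
  ιDEdge-onto (e′ , p , j′ , t′) a b sa tb with ιEdge-onto e′ a b sa tb
  ... | e , refl with ιDEdge′-onto e (orientation e) p j′ t′
  ...   | j , t , ι≡ = (e , p , j , t) , ι≡

  lift-joins : ∀ (d′ : D′.DEdge) a b → D′.src (proj₁ d′) ≡ f a → D′.tgt (proj₁ d′) ≡ f b → ∀ {y′ z′} →
    Joins D′.graph d′ y′ z′ → Σ D.Vert λ y → Σ D.Vert λ z → y′ ≡ ι y × z′ ≡ ι z × Σ D.DEdge λ d →
    Joins D.graph d y z × D′.dneg d′ ≡ D.dneg d xor (switching y xor switching z)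
  lift-joins d′ a b sa tb {y′} {z′} j′ with ιDEdge-onto d′ a b sa tb
  ... | d@(e , p , j , t) , refl with D′.Joins-ends {e = ιDEdge d} j′ (joins-ιDEdge e p j t)
  ...   | inj₁ (y′≡ , z′≡) = _ , _ , y′≡ , z′≡ , d , inj₁ refl , dneg-ιDEdge e p j t
  ...   | inj₂ (y′≡ , z′≡) = _ , _ , y′≡ , z′≡ , d , inj₂ refl ,
          trans (dneg-ιDEdge e p j t) (cong (D.dneg d xor_) (xor-comm (switching (D.vertexAt e p j)) _))

  ι-inner′ : ∀ e (o : Orientation e) p i (t : T (suc i <ᵇ D.len e p)) →
    Σ (T (suc (innerPosition o (D.len e p) i) <ᵇ D′.len (ιEdge′ e o) p)) λ t′ →
      D′.vertexAt (ιEdge′ e o) p (vertexPosition o (D.len e p) (suc i)) ≡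
      inj₂ (ιEdge′ e o , p , innerPosition o (D.len e p) i , t′)
  ι-inner′ e o@(forward _) p i t = t′ , D′.vertexAt-inner _ p i t′
    where t′ = subst (λ L → T (suc i <ᵇ L)) (sym (len-ιEdge′ e o p)) t
  ι-inner′ e o@(backward _) p i t = t′ , trans (cong (D′.vertexAt (ιEdge′ e o) p) (sym position)) (D′.vertexAt-inner _ p _ t′)
    where
      L = D.len e p
      i<L : suc i < L
      i<L = ℕP.<ᵇ⇒< (suc i) L t
      position : suc (L ∸ suc (suc i)) ≡ L ∸ suc i
      position = suc-∸-suc i<L
      t′ : T (suc (L ∸ suc (suc i)) <ᵇ D′.len (ιEdge′ e o) p)
      t′ = ℕP.<⇒<ᵇ (subst₂ _<_ (sym position) (sym (len-ιEdge′ e o p))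
                              (ℕP.∸-monoʳ-< {L} {suc i} {0} (s≤s z≤n) (ℕP.<⇒≤ i<L)))

  ι-inner : ∀ e p i (t : T (suc i <ᵇ D.len e p)) →
    Σ (T (suc (innerPosition (orientation e) (D.len e p) i) <ᵇ D′.len (ιEdge e) p)) λ t′ →
      ι (inj₂ (e , p , i , t)) ≡ inj₂ (ιEdge e , p , innerPosition (orientation e) (D.len e p) i , t′)
  ι-inner e = ι-inner′ e (orientation e)

  innerPosition-injective : ∀ {e} (o : Orientation e) L i i′ → suc i < L → suc i′ < L →
                            innerPosition o L i ≡ innerPosition o L i′ → i ≡ i′
  innerPosition-injective (forward _)  L i i′ _   _    eq = eq
  innerPosition-injective (backward _) L i i′ i<L i′<L eq =
    ℕP.suc-injective (ℕP.suc-injective (ℕP.∸-cancelˡ-≡ i<L i′<L eq))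

  ιEdge′-injective : ∀ e e′ (o : Orientation e) (o′ : Orientation e′) → ιEdge′ e o ≡ ιEdge′ e′ o′ → e ≡ e′
  ιEdge′-injective e e′ (forward _)  (forward _)  eq = D.Edge-≡ (f-injective (cong D′.src eq)) (f-injective (cong D′.tgt eq))
  ιEdge′-injective e e′ (backward _) (backward _) eq = D.Edge-≡ (f-injective (cong D′.tgt eq)) (f-injective (cong D′.src eq))
  ιEdge′-injective e e′ (forward _)  (backward _) eq = ⊥-elim (ℕP.<-asym (D.src<tgt e)
    (subst₂ (λ a b → toℕ a < toℕ b) (sym (f-injective (cong D′.tgt eq))) (sym (f-injective (cong D′.src eq)))
            (D.src<tgt e′)))
  ιEdge′-injective e e′ (backward _) (forward _)  eq = ⊥-elim (ℕP.<-asym (D.src<tgt e)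
    (subst₂ (λ a b → toℕ a < toℕ b) (sym (f-injective (cong D′.src eq))) (sym (f-injective (cong D′.tgt eq)))
            (D.src<tgt e′)))

  ι-injective : Injective _≡_ _≡_ ι
  ι-injective {inj₁ a} {inj₁ b} eq = cong inj₁ (f-injective (SumP.inj₁-injective eq))
  ι-injective {inj₁ a} {inj₂ (e , p , i , t)} eq with trans eq (proj₂ (ι-inner e p i t))
  ... | ()
  ι-injective {inj₂ (e , p , i , t)} {inj₁ a} eq with trans (sym eq) (proj₂ (ι-inner e p i t))
  ... | ()
  ι-injective {inj₂ (e , p , i , t)} {inj₂ (e′ , p′ , i′ , t′)} eq
    with SumP.inj₂-injective (trans (sym (proj₂ (ι-inner e p i t))) (trans eq (proj₂ (ι-inner e′ p′ i′ t′))))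
  ... | eq′ with ιEdge′-injective e e′ (orientation e) (orientation e′) (cong proj₁ eq′)
  ...   | refl with cong (proj₁ ∘ proj₂) eq′
  ...     | refl with innerPosition-injective (orientation e) (D.len e p) i i′
                      (ℕP.<ᵇ⇒< _ _ t) (ℕP.<ᵇ⇒< _ _ t′) (cong (proj₁ ∘ proj₂ ∘ proj₂) eq′)
  ...       | refl = cong (λ t → inj₂ (e , p , i , t)) (T-irrelevant t t′)

  ι-joins : ∀ (d : D.DEdge) {x y} → Joins D.graph d x y →
            Joins D′.graph (ιDEdge d) (ι x) (ι y) × D′.dneg (ιDEdge d) ≡ D.dneg d xor (switching x xor switching y)
  ι-joins (e , p , j , t) (inj₁ refl) = joins-ιDEdge e p j t , dneg-ιDEdge e p j t
  ι-joins (e , p , j , t) (inj₂ refl) = D′.Joins-sym {ιDEdge (e , p , j , t)} (joins-ιDEdge e p j t) ,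
    trans (dneg-ιDEdge e p j t) (cong (D.dneg (e , p , j , t) xor_) (xor-comm (switching (D.vertexAt e p j)) _))

  ι-walk : ∀ {x y} (W : D.Walk x y) → Σ (D′.Walk (ι x) (ι y)) λ W′ →
           D′.length W′ ≡ D.length W × D′.sign W′ ≡ D.sign W xor (switching x xor switching y)
  ι-walk {x} D.[] = D′.[] , refl , sym (xor-same (switching x))
  ι-walk {x} {y} (D.cons {y = z} d j W) with ι-joins d j | ι-walk W
  ... | j′ , dneg≡ | W′ , length≡ , sign≡ =
        D′.cons (ιDEdge d) j′ W′ , cong suc length≡ ,
        trans (cong₂ _xor_ dneg≡ sign≡) (xor-telescope (D.dneg d) (switching x) (switching z) (D.sign W) (switching y))

  lift-joins-from : ∀ (d′ : D′.DEdge) a b → D′.src (proj₁ d′) ≡ f a → D′.tgt (proj₁ d′) ≡ f b → ∀ {x z′} →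
    Joins D′.graph d′ (ι x) z′ → Σ D.Vert λ z → z′ ≡ ι z × Σ D.DEdge λ d →
    Joins D.graph d x z × D′.dneg d′ ≡ D.dneg d xor (switching x xor switching z)
  lift-joins-from d′ a b sa tb {x} j′ with lift-joins d′ a b sa tb j′
  ... | y , z , x≡y , z′≡ , d , j , dneg≡ with ι-injective {x} {y} x≡y
  ...   | refl = z , z′≡ , d , j , dneg≡

  ι-original : ∀ {x v} → ι x ≡ inj₁ v → Σ (Fin m) λ a → x ≡ inj₁ a
  ι-original {inj₁ a} _ = a , refl
  ι-original {inj₂ (e , p , i , t)} eq with trans (sym eq) (proj₂ (ι-inner e p i t))
  ... | ()

  ιEdge-tgt : ∀ e → Σ (Fin m) λ a → D′.tgt (ιEdge e) ≡ f a
  ιEdge-tgt e with orientation e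
  ... | forward _  = D.tgt e , refl
  ... | backward _ = D.src e , refl

  ι-onto-inner : ∀ e′ a b → D′.src e′ ≡ f a → D′.tgt e′ ≡ f b → ∀ p i t →
                 Σ D.Vert λ x → inj₂ (e′ , p , i , t) ≡ ι x
  ι-onto-inner e′ a b sa tb p i t with lift-joins (e′ , p , i , t-edge) a b sa tb {D′.vertexAt e′ p i} (inj₁ refl)
    where t-edge = ℕP.<⇒<ᵇ (ℕP.<-trans (ℕP.n<1+n i) (ℕP.<ᵇ⇒< (suc i) (D′.len e′ p) t))
  ... | _ , x , _ , vertex≡ , _ = x , trans (sym (D′.vertexAt-inner e′ p i t)) vertex≡

  unswitched : (∀ a b → toℕ a < toℕ b → toℕ (f a) < toℕ (f b)) → ∀ x → switching x ≡ false
  unswitched f-monotone (inj₁ _)               = refl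
  unswitched f-monotone (inj₂ (e , p , _ , _)) with orientation e
  ... | forward _    = refl
  ... | backward t<s = ⊥-elim (ℕP.<-asym t<s (f-monotone _ _ (D.src<tgt e)))

fromℕ-or-inject₁ : ∀ {n} (x : Fin (suc n)) → x ≡ fromℕ n ⊎ Σ (Fin n) λ a → x ≡ inject₁ a
fromℕ-or-inject₁ x with view x
... | ‵fromℕ     = inj₁ refl
... | ‵inject₁ a = inj₂ (a , refl)

module Extension
  (k n t : ℕ) (1≤k : 1 ≤ k) (w : WGraph n) (isW : IsWGraph w) (wideH : Wide k w)
  (S : Subset n) (S-clique : ∀ i j → i ∈ S → j ∈ S → i ≢ j → adj w i j ≡ true)
  (w′ : WGraph (suc n)) (isW′ : IsWGraph w′)
  (w′-extends : ∀ i j → w′ (inject₁ i) (inject₁ j) ≡ w i j)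
  (u-adj : ∀ i → adj w′ (fromℕ n) (inject₁ i) ≡ lookup S i)
  (u-bounded : ∀ i → ∣ w′ (fromℕ n) (inject₁ i) ∣ ≤ k)
  (φ : Fin (suc t) → Fin (suc n)) (φ-injective : Injective _≡_ _≡_ φ)
  (φ-image : ∀ v → (∃ λ i → φ i ≡ v) ⇔ ((v ≡ fromℕ n) ⊎ (∃ λ i → (v ≡ inject₁ i) × (i ∈ S))))
  (wideK : Wide k (λ i j → w′ (φ i) (φ j)))
  where

  u : Fin (suc n)
  u = fromℕ n

  wK : WGraph (suc t)
  wK i j = w′ (φ i) (φ j)

  isWK : IsWGraph wK
  isWK = (λ i j → proj₁ isW′ (φ i) (φ j)) , (λ i → proj₂ isW′ (φ i))

  module H  = DoubleGraph k w
  module H′ = DoubleGraph k w′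
  module K  = DoubleGraph k wK
  module ιH = Embedding k w w′ inject₁ FinP.inject₁-injective w′-extends (proj₁ isW′)
  module ιK = Embedding k wK w′ φ φ-injective (λ _ _ → refl) (proj₁ isW′)

  φ-onto-S : ∀ a → a ∈ S → Σ (Fin (suc t)) λ c → φ c ≡ inject₁ a
  φ-onto-S a a∈S = Equivalence.from (φ-image (inject₁ a)) (inj₂ (a , refl , a∈S))

  φ-onto-u : Σ (Fin (suc t)) λ c → φ c ≡ u
  φ-onto-u = Equivalence.from (φ-image u) (inj₁ refl)

  φ-into-S : ∀ c a → φ c ≡ inject₁ a → a ∈ S
  φ-into-S c a φc≡a with Equivalence.to (φ-image (inject₁ a)) (c , φc≡a)
  ... | inj₁ a≡u              = ⊥-elim (FinP.fromℕ≢inject₁ (sym a≡u))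
  ... | inj₂ (a′ , a≡a′ , a′∈S) = subst (_∈ S) (sym (FinP.inject₁-injective a≡a′)) a′∈S

  src≢u : ∀ e′ → H′.src e′ ≢ u
  src≢u e′ src≡u = ℕP.<-irrefl refl (ℕP.<-≤-trans n<tgt (ℕ.s≤s⁻¹ (FinP.toℕ<n (H′.tgt e′))))
    where n<tgt = subst (_< toℕ (H′.tgt e′)) (trans (cong toℕ src≡u) (FinP.toℕ-fromℕ n)) (H′.src<tgt e′)

  old-src : ∀ e′ → Σ (Fin n) λ a → H′.src e′ ≡ inject₁ a
  old-src e′ with fromℕ-or-inject₁ (H′.src e′)
  ... | inj₁ src≡u = ⊥-elim (src≢u e′ src≡u)
  ... | inj₂ (a , src≡a) = a , src≡a

  uEdge-src : ∀ e′ → H′.tgt e′ ≡ u → Σ (Fin n) λ a → H′.src e′ ≡ inject₁ a × a ∈ S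
  uEdge-src e′ tgt≡u with old-src e′
  ... | a , src≡a = a , src≡a , lookup⇒[]= a S (begin
    lookup S a                      ≡⟨ sym (u-adj a) ⟩
    adj w′ u (inject₁ a)            ≡⟨ adj-sym w′ (proj₁ isW′) u (inject₁ a) ⟩
    adj w′ (inject₁ a) u            ≡⟨ sym (cong₂ (adj w′) src≡a tgt≡u) ⟩
    adj w′ (H′.src e′) (H′.tgt e′)  ≡⟨ H′.adj-src-tgt e′ ⟩
    true                            ∎)
    where open ≡-Reasoning

  uEdge-in-K : ∀ e′ → H′.tgt e′ ≡ u →
               Σ (Fin (suc t)) λ α → Σ (Fin (suc t)) λ β → H′.src e′ ≡ φ α × H′.tgt e′ ≡ φ β
  uEdge-in-K e′ tgt≡u with uEdge-src e′ tgt≡u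
  ... | a , src≡a , a∈S with φ-onto-S a a∈S | φ-onto-u
  ...   | α , φα≡a | β , φβ≡u = α , β , trans src≡a (sym φα≡a) , trans tgt≡u (sym φβ≡u)

  oldEdge-in-H : ∀ e′ → H′.tgt e′ ≢ u →
                 Σ (Fin n) λ a → Σ (Fin n) λ b → H′.src e′ ≡ inject₁ a × H′.tgt e′ ≡ inject₁ b
  oldEdge-in-H e′ tgt≢u with old-src e′ | fromℕ-or-inject₁ (H′.tgt e′)
  ... | _       | inj₁ tgt≡u       = ⊥-elim (tgt≢u tgt≡u)
  ... | a , sa  | inj₂ (b , tb)    = a , b , sa , tb

  -- The vertices of D(H′) outside the image of D(H): u and the inner vertices of the gadgets of
  -- edges at u.  Edges are stored with src < tgt, so the edges at u = fromℕ n are those with tgt u.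
  IsNew : H′.Vert → Set
  IsNew (inj₁ c)             = c ≡ u
  IsNew (inj₂ (e′ , _))      = H′.tgt e′ ≡ u

  ιH-old : ∀ x → ¬ IsNew (ιH.ι x)
  ιH-old (inj₁ a) new = FinP.fromℕ≢inject₁ (sym new)
  ιH-old (inj₂ (e , p , i , t)) new with ιH.ιEdge-tgt e
  ... | b , tgt≡b = FinP.fromℕ≢inject₁ (trans (sym (subst IsNew (proj₂ (ιH.ι-inner e p i t)) new)) tgt≡b)

  new-or-old : ∀ v′ → IsNew v′ ⊎ Σ H.Vert λ x → v′ ≡ ιH.ι x
  new-or-old (inj₁ c) with fromℕ-or-inject₁ c
  ... | inj₁ c≡u       = inj₁ c≡u
  ... | inj₂ (a , c≡a) = inj₂ (inj₁ a , cong inj₁ c≡a)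
  new-or-old (inj₂ (e′ , p , i , t)) with fromℕ-or-inject₁ (H′.tgt e′)
  ... | inj₁ tgt≡u      = inj₁ tgt≡u
  ... | inj₂ (b , tgt≡b) with oldEdge-in-H e′ (λ tgt≡u → FinP.fromℕ≢inject₁ (trans (sym tgt≡u) tgt≡b))
  ...   | a , b′ , sa , tb = inj₂ (ιH.ι-onto-inner e′ a b′ sa tb p i t)

  new⇒ιK : ∀ v′ → IsNew v′ → Σ K.Vert λ α → v′ ≡ ιK.ι α
  new⇒ιK (inj₁ c) c≡u = inj₁ (proj₁ φ-onto-u) , cong inj₁ (trans c≡u (sym (proj₂ φ-onto-u)))
  new⇒ιK (inj₂ (e′ , p , i , t)) tgt≡u with uEdge-in-K e′ tgt≡u
  ... | α , β , sα , tβ = ιK.ι-onto-inner e′ α β sα tβ p i t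

  vertexAt-uEdge : ∀ e′ p j → H′.tgt e′ ≡ u → IsNew (H′.vertexAt e′ p j) ⊎ H′.vertexAt e′ p j ≡ inj₁ (H′.src e′)
  vertexAt-uEdge e′ p zero    tgt≡u = inj₂ refl
  vertexAt-uEdge e′ p (suc i) tgt≡u with T? (suc i <ᵇ H′.len e′ p)
  ... | yes _ = inj₁ tgt≡u
  ... | no _  = inj₁ tgt≡u

  new-vertexAt⇒uEdge : ∀ e′ p j → IsNew (H′.vertexAt e′ p j) → H′.tgt e′ ≡ u
  new-vertexAt⇒uEdge e′ p zero    new = ⊥-elim (src≢u e′ new)
  new-vertexAt⇒uEdge e′ p (suc i) new with T? (suc i <ᵇ H′.len e′ p)
  ... | yes _ = new
  ... | no _  = new

  uEdge-endpoint : ∀ d {v′ z′} → Joins H′.graph d v′ z′ → H′.tgt (proj₁ d) ≡ u →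
                   IsNew v′ ⊎ v′ ≡ inj₁ (H′.src (proj₁ d))
  uEdge-endpoint (e′ , p , j , t) jn tgt≡u with H′.endpoint-vertexAt e′ p j t jn
  ... | inj₁ refl = vertexAt-uEdge e′ p j tgt≡u
  ... | inj₂ refl = vertexAt-uEdge e′ p (suc j) tgt≡u

  new-endpoint⇒uEdge : ∀ d {v′ z′} → Joins H′.graph d v′ z′ → IsNew v′ → H′.tgt (proj₁ d) ≡ u
  new-endpoint⇒uEdge (e′ , p , j , t) jn new with H′.endpoint-vertexAt e′ p j t jn
  ... | inj₁ refl = new-vertexAt⇒uEdge e′ p j new
  ... | inj₂ refl = new-vertexAt⇒uEdge e′ p (suc j) new

  lift-uStep : ∀ d {v′ z′} α → Joins H′.graph d v′ z′ → v′ ≡ ιK.ι α → H′.tgt (proj₁ d) ≡ u →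
    Σ K.Vert λ β → z′ ≡ ιK.ι β × Σ K.DEdge λ d₀ →
      Joins K.graph d₀ α β × H′.dneg d ≡ K.dneg d₀ xor (ιK.switching α xor ιK.switching β)
  lift-uStep d α jn refl tgt≡u with uEdge-in-K (proj₁ d) tgt≡u
  ... | α′ , β′ , sα , tβ = ιK.lift-joins-from d α′ β′ sα tβ jn

  ιH-unswitched : ∀ x → ιH.switching x ≡ false
  ιH-unswitched = ιH.unswitched (λ a b a<b → subst₂ ℕ._<_ (sym (FinP.toℕ-inject₁ a)) (sym (FinP.toℕ-inject₁ b)) a<b)

  lift-oldStep : ∀ d {v′ z′} x → Joins H′.graph d v′ z′ → v′ ≡ ιH.ι x → H′.tgt (proj₁ d) ≢ u →
    Σ H.Vert λ z → z′ ≡ ιH.ι z × Σ H.DEdge λ d₀ → Joins H.graph d₀ x z × H′.dneg d ≡ H.dneg d₀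
  lift-oldStep d x jn refl tgt≢u with oldEdge-in-H (proj₁ d) tgt≢u
  ... | a , b , sa , tb with ιH.lift-joins-from d a b sa tb jn
  ...   | z , z′≡ , d₀ , j₀ , dneg≡ = z , z′≡ , d₀ , j₀ ,
          trans dneg≡ (trans (cong₂ (λ p q → H.dneg d₀ xor (p xor q)) (ιH-unswitched x) (ιH-unswitched z))
                             (xor-identityʳ _))

  after-uStep : ∀ d {v′ z′ β} → Joins H′.graph d v′ z′ → H′.tgt (proj₁ d) ≡ u → z′ ≡ ιK.ι β →
                IsNew z′ ⊎ Σ (Fin (suc t)) λ c → β ≡ inj₁ c
  after-uStep d jn tgt≡u z′≡ with uEdge-endpoint d (H′.Joins-sym {d} jn) tgt≡u
  ... | inj₁ new    = inj₁ new
  ... | inj₂ z′≡src = inj₂ (ιK.ι-original (trans (sym z′≡) z′≡src))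

  clique-detour : ∀ {a b c₀ c} → φ c₀ ≡ inject₁ a → φ c ≡ inject₁ b → a ∈ S → b ∈ S →
    (Q : K.Walk (inj₁ c₀) (inj₁ c)) → K.length Q < 2 * k →
    Σ (H.Walk (inj₁ a) (inj₁ b)) λ R → H.length R ≤ K.length Q × H.sign R ≡ K.sign Q
  clique-detour {a} {b} {c₀} {c} φc₀≡a φc≡b a∈S b∈S Q Q<2k with c₀ FinP.≟ c
  ... | yes refl with FinP.inject₁-injective (trans (sym φc₀≡a) φc≡b)
  ...   | refl = H.[] , z≤n , sym (K.noShortNegClosedWalk isWK 1≤k wideK Q Q<2k)
  clique-detour {a} {b} {c₀} {c} φc₀≡a φc≡b a∈S b∈S Q Q<2k | no c₀≢c =
    proj₁ R , subst (_≤ K.length Q) (trans (cong (pathLength k p) wK≡w) (sym (proj₁ (proj₂ R)))) (proj₁ (proj₂ dominated)) ,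
    trans (proj₂ (proj₂ R)) (trans (cong (pathSign p) (sym wK≡w)) (proj₂ (proj₂ dominated)))
    where
      wK≡w = trans (cong₂ w′ φc₀≡a φc≡b) (w′-extends a b)
      ab = S-clique a b a∈S b∈S λ { refl → c₀≢c (φ-injective (trans φc₀≡a (sym φc≡b))) }
      dominated = K.shortWalk-dominates-gadget isWK 1≤k wideK (trans (adj-cong wK w wK≡w) ab) Q Q<2k
      p = proj₁ dominated
      R = H.gadgetBetween isW 1≤k a b ab (proj₁ wideH a b ab) p

  Projection : H.Vert → H.Vert → ℕ → Bool → Set
  Projection x y L s = Σ (H.Walk x y) λ R → H.length R ≤ L × H.sign R ≡ s

  prepend-old : ∀ {x z y L s} d₀ → Joins H.graph d₀ x z → Projection z y L s →
                Projection x y (suc L) (H.dneg d₀ xor s)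
  prepend-old d₀ j₀ (R , R≤L , sign≡) = H.cons d₀ j₀ R , s≤s R≤L , cong (H.dneg d₀ xor_) sign≡

  record Detour (α : K.Vert) (y : H.Vert) (L : ℕ) (s : Bool) : Set where
    field
      {c}   : Fin (suc t)
      {b}   : Fin n
      φc≡b  : φ c ≡ inject₁ b
      Q     : K.Walk α (inj₁ c)
      R     : H.Walk (inj₁ b) y
      short : K.length Q + H.length R ≤ L
      sign≡ : s ≡ K.sign Q xor (ιK.switching α xor H.sign R)

  prepend-new : ∀ {α β y L s s₀} d₀ → Joins K.graph d₀ α β → s₀ ≡ K.dneg d₀ xor (ιK.switching α xor ιK.switching β) →
                Detour β y L s → Detour α y (suc L) (s₀ xor s)
  prepend-new {α} {β} d₀ j₀ s₀≡ D = record
    { φc≡b = φc≡b ; Q = K.cons d₀ j₀ Q ; R = R ; short = s≤s short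
    ; sign≡ = trans (cong₂ _xor_ s₀≡ sign≡)
                    (xor-telescope (K.dneg d₀) (ιK.switching α) (ιK.switching β) (K.sign Q) (H.sign R)) }
    where open Detour D

  clique-arrival : ∀ {v′ α x} → v′ ≡ ιK.ι α → v′ ≡ ιH.ι x → IsNew v′ ⊎ Σ (Fin (suc t)) (λ c → α ≡ inj₁ c) →
    Σ (Fin (suc t)) λ c → Σ (Fin n) λ b → α ≡ inj₁ c × x ≡ inj₁ b × φ c ≡ inject₁ b
  clique-arrival {x = x} v′≡α v′≡x (inj₁ new) = ⊥-elim (ιH-old x (subst IsNew v′≡x new))
  clique-arrival {x = x} v′≡α v′≡x (inj₂ (c , refl)) with ιH.ι-original {x} (trans (sym v′≡x) v′≡α)
  ... | b , refl = c , b , refl , refl , SumP.inj₁-injective (trans (sym v′≡α) v′≡x)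

  arrive : ∀ {α x y L s} → (Σ (Fin (suc t)) λ c → Σ (Fin n) λ b → α ≡ inj₁ c × x ≡ inj₁ b × φ c ≡ inject₁ b) →
           Projection x y L s → Detour α y L s
  arrive (c , b , refl , refl , φc≡b) (R , R≤L , sign≡) =
    record { φc≡b = φc≡b ; Q = K.[] ; R = R ; short = R≤L ; sign≡ = sym sign≡ }

  record Entry (x : H.Vert) (d : H′.DEdge) (z′ : H′.Vert) : Set where
    field
      {a}   : Fin n
      {c₀}  : Fin (suc t)
      {β}   : K.Vert
      x≡a   : x ≡ inj₁ a
      a∈S   : a ∈ S
      φc₀≡a : φ c₀ ≡ inject₁ a
      z′≡β  : z′ ≡ ιK.ι β
      β-inv : IsNew z′ ⊎ Σ (Fin (suc t)) λ c → β ≡ inj₁ c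
      d₀    : K.DEdge
      j₀    : Joins K.graph d₀ (inj₁ c₀) β
      dneg≡ : H′.dneg d ≡ K.dneg d₀ xor ιK.switching β

  enter : ∀ d {v′ z′} x → Joins H′.graph d v′ z′ → v′ ≡ ιH.ι x → H′.tgt (proj₁ d) ≡ u → Entry x d z′
  enter d x jn v′≡x tgt≡u with uEdge-endpoint d jn tgt≡u
  ... | inj₁ new = ⊥-elim (ιH-old x (subst IsNew v′≡x new))
  ... | inj₂ v′≡src with uEdge-src (proj₁ d) tgt≡u
  ...   | a , src≡a , a∈S with φ-onto-S a a∈S
  ...     | c₀ , φc₀≡a with lift-uStep d (inj₁ c₀) jn (trans v′≡src (cong inj₁ (trans src≡a (sym φc₀≡a)))) tgt≡u
  ...       | β , z′≡β , d₀ , j₀ , dneg≡ = record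
    { x≡a = ιH.ι-injective (trans (sym v′≡x) (trans v′≡src (cong inj₁ src≡a))) ; a∈S = a∈S ; φc₀≡a = φc₀≡a
    ; z′≡β = z′≡β ; β-inv = after-uStep d jn tgt≡u z′≡β ; d₀ = d₀ ; j₀ = j₀ ; dneg≡ = dneg≡ }

  exit : ∀ {x d z′ y L s} (E : Entry x d z′) → Detour (Entry.β E) y L s → suc L < 2 * k →
         Projection x y (suc L) (H′.dneg d xor s)
  exit {d = d} {y = y} {L} {s} E D L<2k =
    subst (λ x → Projection x y (suc L) _) (sym x≡a) (R₁ H.++ R , R₁R≤L , sign≡′)
    where
      open Entry E
      open Detour D
      Q′ = K.cons d₀ j₀ Q
      Q′≤L : K.length Q′ ≤ suc L
      Q′≤L = s≤s (ℕP.≤-trans (ℕP.m≤m+n _ _) short)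
      clique = clique-detour φc₀≡a φc≡b a∈S (φ-into-S _ _ φc≡b) Q′ (ℕP.≤-<-trans Q′≤L L<2k)
      R₁ = proj₁ clique
      R₁R≤L : H.length (R₁ H.++ R) ≤ suc L
      R₁R≤L = subst (_≤ suc L) (sym (H.length-++ R₁ R))
                (ℕP.≤-trans (ℕP.+-monoˡ-≤ (H.length R) (proj₁ (proj₂ clique))) (s≤s short))
      sign≡′ : H.sign (R₁ H.++ R) ≡ H′.dneg d xor s
      sign≡′ = begin
        H.sign (R₁ H.++ R)                     ≡⟨ H.sign-++ R₁ R ⟩
        H.sign R₁ xor H.sign R                 ≡⟨ cong (_xor H.sign R) (proj₂ (proj₂ clique)) ⟩
        (K.dneg d₀ xor K.sign Q) xor H.sign R
          ≡⟨ sym (xor-telescope (K.dneg d₀) false (ιK.switching β) (K.sign Q) (H.sign R)) ⟩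
        (K.dneg d₀ xor ιK.switching β) xor (K.sign Q xor (ιK.switching β xor H.sign R))
                                               ≡⟨ cong₂ _xor_ (sym dneg≡) (sym sign≡) ⟩
        H′.dneg d xor s                        ∎
        where open ≡-Reasoning

  -- project replaces every excursion of W through u by a clique detour in D(H); detour follows
  -- such an excursion inside D(K) until it is back at a vertex of D(H).
  project : ∀ {v′ y′} (W : H′.Walk v′ y′) x y → v′ ≡ ιH.ι x → y′ ≡ ιH.ι y → H′.length W < 2 * k →
            Projection x y (H′.length W) (H′.sign W)
  detour : ∀ {v′ y′} (W : H′.Walk v′ y′) α → v′ ≡ ιK.ι α → IsNew v′ ⊎ Σ (Fin (suc t)) (λ c → α ≡ inj₁ c) →
           ∀ y → y′ ≡ ιH.ι y → H′.length W < 2 * k → Detour α y (H′.length W) (H′.sign W)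
  detour-new : ∀ {v′ y′} (W : H′.Walk v′ y′) α → v′ ≡ ιK.ι α → IsNew v′ →
               ∀ y → y′ ≡ ιH.ι y → H′.length W < 2 * k → Detour α y (H′.length W) (H′.sign W)

  project H′.[] x y v′≡x v′≡y _ =
    subst (λ y → Projection x y 0 false) (ιH.ι-injective (trans (sym v′≡x) v′≡y)) (H.[] , z≤n , refl)
  project (H′.cons d jn W) x y v′≡x y′≡y W<2k with fromℕ-or-inject₁ (H′.tgt (proj₁ d))
  ... | inj₁ tgt≡u = exit entry (detour W β z′≡β β-inv y y′≡y (ℕP.<-trans (ℕP.n<1+n _) W<2k)) W<2k
    where entry = enter d x jn v′≡x tgt≡u
          open Entry entry
  ... | inj₂ (b , tgt≡b) =
    let (z , z′≡z , d₀ , j₀ , dneg≡) = lift-oldStep d x jn v′≡x (λ tgt≡u → FinP.fromℕ≢inject₁ (trans (sym tgt≡u) tgt≡b))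
    in subst (λ s → Projection x y _ (s xor H′.sign W)) (sym dneg≡)
             (prepend-old d₀ j₀ (project W z y z′≡z y′≡y (ℕP.<-trans (ℕP.n<1+n _) W<2k)))

  detour {v′} W α v′≡α inv y y′≡y W<2k with new-or-old v′
  ... | inj₂ (x , v′≡x) = arrive (clique-arrival v′≡α v′≡x inv) (project W x y v′≡x y′≡y W<2k)
  ... | inj₁ new        = detour-new W α v′≡α new y y′≡y W<2k

  detour-new H′.[] α v′≡α new y v′≡y _ = ⊥-elim (ιH-old y (subst IsNew v′≡y new))
  detour-new (H′.cons d jn W) α v′≡α new y y′≡y W<2k =
    let tgt≡u = new-endpoint⇒uEdge d jn new
        (β , z′≡β , d₀ , j₀ , dneg≡) = lift-uStep d α jn v′≡α tgt≡u
    in prepend-new d₀ j₀ dneg≡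
         (detour W β z′≡β (after-uStep d jn tgt≡u z′≡β) y y′≡y (ℕP.<-trans (ℕP.n<1+n _) W<2k))

  closedWalkAtOld-positive : ∀ {v′} (W : H′.Walk v′ v′) x → v′ ≡ ιH.ι x → H′.length W < 2 * k → H′.sign W ≡ false
  closedWalkAtOld-positive W x v′≡x W<2k =
    let (R , R≤W , sign≡) = project W x x v′≡x v′≡x W<2k
    in trans (sym sign≡) (H.noShortNegClosedWalk isW 1≤k wideH R (ℕP.≤-<-trans R≤W W<2k))

  visitsOld-or-liftsToK : ∀ {v′ y′} (W : H′.Walk v′ y′) α → v′ ≡ ιK.ι α →
    (Σ ℕ λ p → Σ H.Vert λ x → H′.vertex W p ≡ ιH.ι x) ⊎
    (Σ K.Vert λ β → y′ ≡ ιK.ι β × Σ (K.Walk α β) λ Q →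
       K.length Q ≡ H′.length W × H′.sign W ≡ K.sign Q xor (ιK.switching α xor ιK.switching β))
  visitsOld-or-liftsToK {v′} W α v′≡α with new-or-old v′
  ... | inj₂ (x , v′≡x) = inj₁ (0 , x , v′≡x)
  visitsOld-or-liftsToK H′.[] α v′≡α | inj₁ new =
    inj₂ (α , v′≡α , K.[] , refl , sym (xor-same (ιK.switching α)))
  visitsOld-or-liftsToK (H′.cons d jn W) α v′≡α | inj₁ new with lift-uStep d α jn v′≡α (new-endpoint⇒uEdge d jn new)
  ... | β , z′≡β , d₀ , j₀ , dneg≡ with visitsOld-or-liftsToK W β z′≡β
  ...   | inj₁ (p , x , p≡x) = inj₁ (suc p , x , p≡x)
  ...   | inj₂ (γ , y′≡γ , Q , Q≡W , sign≡) = inj₂ (γ , y′≡γ , K.cons d₀ j₀ Q , cong suc Q≡W ,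
          trans (cong₂ _xor_ dneg≡ sign≡)
                (xor-telescope (K.dneg d₀) (ιK.switching α) (ιK.switching β) (K.sign Q) (ιK.switching γ)))

  noShortNegClosedWalk : ∀ {v′} (W : H′.Walk v′ v′) → H′.length W < 2 * k → H′.sign W ≡ false
  noShortNegClosedWalk {v′} W W<2k with new-or-old v′
  ... | inj₂ (x , v′≡x) = closedWalkAtOld-positive W x v′≡x W<2k
  ... | inj₁ new with new⇒ιK v′ new
  ...   | α , v′≡α with visitsOld-or-liftsToK W α v′≡α
  ...     | inj₁ (p , x , p≡x) = trans (sym (H′.sign-rotate p W))
            (closedWalkAtOld-positive (H′.rotate p W) x p≡x (subst (_< 2 * k) (sym (H′.length-rotate p W)) W<2k))
  ...     | inj₂ (β , v′≡β , Q , Q≡W , sign≡) with ιK.ι-injective {α} {β} (trans (sym v′≡α) v′≡β)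
  ...       | refl = trans sign≡ (cong₂ _xor_ (K.noShortNegClosedWalk isWK 1≤k wideK Q (subst (_< 2 * k) (sym Q≡W) W<2k))
                                               (xor-same (ιK.switching α)))

  noShortNegCycle : ∀ ℓ → ℓ < 2 * k → ¬ NegCycle H′.graph ℓ
  noShortNegCycle = H′.noShortNegClosedWalk⇒noShortNegCycle noShortNegClosedWalk

  negCycle-2k : NegCycle H′.graph (2 * k)
  negCycle-2k with H.negCycle⇒closedWalk (proj₁ (proj₂ wideH))
  ... | x , W , W≡2k , negative with ιH.ι-walk W
  ...   | W′ , W′≡W , sign≡ = H′.negCycle-of-girth H′._≟ᵛ_ noShortNegCycle W′ (trans W′≡W W≡2k)
          (trans sign≡ (cong₂ _xor_ negative (xor-same (ιH.switching x))))

  weights-bounded : ∀ x y → adj w′ x y ≡ true → ∣ w′ x y ∣ ≤ k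
  weights-bounded x y xy with view x | view y
  ... | ‵fromℕ     | ‵fromℕ     = ⊥-elim (not-¬ refl (trans (sym xy) (adj-irrefl w′ (proj₂ isW′) u)))
  ... | ‵fromℕ     | ‵inject₁ b = u-bounded b
  ... | ‵inject₁ a | ‵fromℕ     = subst (λ z → ∣ z ∣ ≤ k) (proj₁ isW′ u (inject₁ a)) (u-bounded a)
  ... | ‵inject₁ a | ‵inject₁ b = subst (λ z → ∣ z ∣ ≤ k) (sym (w′-extends a b))
                                    (proj₁ wideH a b (trans (sym (ιH.adj-f a b)) xy))

lemma1 : (k t n : ℕ) → 1 ≤ k → 1 ≤ t →
    -- (H , w): a 2k-wide bipartite signed edge-weighted t-tree on Fin n
    (w : WGraph n) → IsWGraph w → IsTTree t w → Bipartite w → Wide k w →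
    -- a t-clique S of H
    (S : Subset n) → Sub.∣ S ∣ ≡ t →
    (∀ i j → i ∈ S → j ∈ S → i ≢ j → adj w i j ≡ true) →
    -- the extended graph on Fin (suc n), new vertex u = fromℕ n adjacent exactly to S
    (w′ : WGraph (suc n)) → IsWGraph w′ →
    (∀ i j → w′ (inject₁ i) (inject₁ j) ≡ w i j) →
    (∀ i → adj w′ (fromℕ n) (inject₁ i) ≡ lookup S i) →
    (∀ i → ∣ w′ (fromℕ n) (inject₁ i) ∣ ≤ k) →
    -- the (t+1)-clique K on S ∪ {u}, enumerated by an injection φ
    (φ : Fin (suc t) → Fin (suc n)) → Injective _≡_ _≡_ φ →
    (∀ v → (∃ λ i → φ i ≡ v) ⇔ ((v ≡ fromℕ n) ⊎ (∃ λ i → (v ≡ inject₁ i) × (i ∈ S)))) →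
    Bipartite (λ i j → w′ (φ i) (φ j)) → Wide k (λ i j → w′ (φ i) (φ j)) →
    Wide k w′
lemma1 k t n 1≤k _ w isW _ _ wideH S _ S-clique w′ isW′ w′-extends u-adj u-bounded φ φ-injective φ-image _ wideK =
  weights-bounded , negCycle-2k , noShortNegCycle
  where open Extension k n t 1≤k w isW wideH S S-clique w′ isW′ w′-extends u-adj u-bounded φ φ-injective φ-image wideK
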